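{- If the nested sequent $\Gamma\vdash\Delta$ is derivable in $\mathbf{N}\text{ - }\mathbf{LBiI}$, then the labelled sequent $[\![\Gamma\vdash\Delta]\!]_x$ is derivable in $\mathbf{L}\text{ - }\mathbf{LBiI}$ for any label $x$.
   Context: Formulas: $A,B ::= p \mid \top \mid \bot \mid A\wedge B \mid A \vee B \mid A \supset B \mid A \mathbin{ -\!\!<} B$ ($p$ propositional variables; $\mathbin{ -\!\!<}$ is exclusion). Nested sequents $S::=\Gamma\vdash\Delta$ with nested contexts $\Gamma,\Delta::=\emptyset\mid A,\Gamma\mid S,\Gamma$ (finite multisets of formulas and nested sequents). The calculus $\mathbf{N}\text{ - }\mathbf{LBiI}$ (premises $\Rightarrow$ conclusion): hyp: $\Gamma,A\vdash A,\Delta$; cut: $\Gamma\vdash A,\Delta$ and $\Gamma,A\vdash\Delta\Rightarrow\Gamma\vdash\Delta$; weakL/R: $\Gamma\vdash\Delta\Rightarrow\Gamma,A\vdash\Delta$ / $\Gamma\vdash A,\Delta$; contrL/R: $\Gamma,A,A\vdash\Delta\Rightarrow\Gamma,A\vdash\Delta$ / $\Gamma\vdash A,A,\Delta\Rightarrow\Gamma\vdash A,\Delta$; $\top$L: $\Gamma\vdash\Delta\Rightarrow\Gamma,\top\vdash\Delta$; $\top$R: $\Gamma\vdash\top,\Delta$; $\bot$L: $\Gamma,\bot\vdash\Delta$; $\bot$R: $\Gamma\vdash\Delta\Rightarrow\Gamma\vdash\bot,\Delta$; $\wedge$L: $\Gamma,A,B\vdash\Delta\Rightarrow\Gamma,A\wedge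 B\vdash\Delta$; $\wedge$R: $\Gamma\vdash A,\Delta$ and $\Gamma\vdash B,\Delta\Rightarrow\Gamma\vdash A\wedge B,\Delta$; $\vee$L: $\Gamma,A\vdash\Delta$ and $\Gamma,B\vdash\Delta\Rightarrow\Gamma,A\vee B\vdash\Delta$; $\vee$R: $\Gamma\vdash A,B,\Delta\Rightarrow\Gamma\vdash A\vee B,\Delta$; $\supset$L: $\Gamma,A\supset B\vdash A,\Delta$ and $\Gamma,B\vdash\Delta\Rightarrow\Gamma,A\supset B\vdash\Delta$; $\supset$R: $\Gamma,A\vdash B\Rightarrow\Gamma\vdash A\supset B,\Delta$; $\mathbin{ -\!\!<}$L: $A\vdash B,\Delta\Rightarrow\Gamma,A\mathbin{ -\!\!<}B\vdash\Delta$; $\mathbin{ -\!\!<}$R: $\Gamma\vdash A,\Delta$ and $\Gamma,B\vdash A\mathbin{ -\!\!<}B,\Delta\Rightarrow\Gamma\vdash A\mathbin{ -\!\!<}B,\Delta$; nestL: $\Gamma_0\vdash\Delta_0,\Delta\Rightarrow\Gamma,(\Gamma_0\vdash\Delta_0)\vdash\Delta$; nestR: $\Gamma,\Gamma_0\vdash\Delta_0\Rightarrow\Gamma\vdash(\Gamma_0\vdash\Delta_0),\Delta$; unnestL: $\Gamma,(\Gamma_0\vdash\Delta_0)\vdash\Delta\Rightarrow\Gamma,\Gamma_0\vdash\Delta_0,\Delta$; unnestR: $\Gamma\vdash(\Gamma_0\vdash\Delta_0),\Delta\Rightarrow\Gamma,\Gamma_0\vdash\Delta_0,\Delta$. Label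 trees: finite directed graphs $G$ with nonempty node set $\mathrm{nodes}(G)$ such that any two nodes are connected by exactly one path of forward/backward arcs; $xGy$ means an arc $x\to y$. $\{x\}$ is the one-node tree, $(x,y)$ the tree with one arc $x\to y$, $G\oplus_x G'$ (defined only if $\mathrm{nodes}(G)\cap\mathrm{nodes}(G')=\{x\}$) the union graph; $G[y/x]$, $\Gamma[y/x]$ rename $x$ to $y$. A labelled sequent $\Gamma\vdash_G\Delta$ has $\Gamma,\Delta$ finite multisets of labelled formulas $x:A$ with $x\in\mathrm{nodes}(G)$. Rules of $\mathbf{L}\text{ - }\mathbf{LBiI}$ (well-definedness of every $\oplus$ is a proviso): hyp: $\Gamma,x:A\vdash_G x:A,\Delta$; cut: $\Gamma\vdash_G x:A,\Delta$ and $\Gamma,x:A\vdash_G\Delta\Rightarrow\Gamma\vdash_G\Delta$; weakL/R and contrL/R on labelled formulas as in the unlabelled case; nodesplitU: if no $z$ has $zGx$, $\Gamma\vdash_{G_0\oplus_y G[y/x]}\Delta\Rightarrow\Gamma\vdash_{G_0\oplus_y(y,x)\oplus_x G}\Delta$; nodesplitD: if no $z$ has $xGz$, $\Gamma\vdash_{G[y/x]\oplus_y G_0}\Delta\Rightarrow\Gamma\vdash_{G\oplus_x(x,y)\oplus_y G_0}\Delta$; nodemergeD: $\Gamma\vdash_{G_0\oplus_y(y,x)\oplus_x G}\Delta\Rightarrow\Gamma[x/y]\vdash_{G_0[x/y]\oplus_x G}\Delta[x/y]$; nodemergeU: $\Gamma\vdash_{G\oplus_x(x,y)\oplus_y G_0}\Delta\Rightarrow\Gamma[x/y]\vdash_{G\oplus_x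 G_0[x/y]}\Delta[x/y]$; monotL: if $xGy$, $\Gamma,x:A,y:A\vdash_G\Delta\Rightarrow\Gamma,x:A\vdash_G\Delta$; monotR: if $yGx$, $\Gamma\vdash_G y:A,x:A,\Delta\Rightarrow\Gamma\vdash_G x:A,\Delta$; $\top$L, $\top$R, $\bot$L, $\bot$R, $\wedge$L, $\wedge$R, $\vee$L, $\vee$R, $\supset$L, $\mathbin{ -\!\!<}$R: as the $\mathbf{N}\text{ - }\mathbf{LBiI}$ rules with every principal and side formula carrying the same label $x$ and the tree $G$ unchanged (e.g. $\supset$L: $\Gamma,x:A\supset B\vdash_G x:A,\Delta$ and $\Gamma,x:B\vdash_G\Delta\Rightarrow\Gamma,x:A\supset B\vdash_G\Delta$); $\supset$R ($y\notin\mathrm{nodes}(G)$): $\Gamma,y:A\vdash_{G\oplus_x(x,y)}y:B,\Delta\Rightarrow\Gamma\vdash_G x:A\supset B,\Delta$; $\mathbin{ -\!\!<}$L ($y\notin\mathrm{nodes}(G)$): $\Gamma,y:A\vdash_{(y,x)\oplus_x G}y:B,\Delta\Rightarrow\Gamma,x:A\mathbin{ -\!\!<}B\vdash_G\Delta$. Translation $[\![\cdot]\!]_x$ from nested to labelled sequents, by recursion: $[\![\,\vdash\,]\!]_x = (\ \vdash_{\{x\}}\ )$; if $[\![\vdash\Delta]\!]_x=\Lambda\vdash_G\Pi$ then $[\![\vdash A,\Delta]\!]_x=\Lambda\vdash_G x:A,\Pi$ and, for a fresh label $y$ with $[\![\Gamma_0\vdash\Delta_0]\!]_y=\Lambda_0\vdash_{G_0}\Pi_0$,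 $[\![\vdash(\Gamma_0\vdash\Delta_0),\Delta]\!]_x=\Lambda,\Lambda_0\vdash_{G\oplus_x(x,y)\oplus_y G_0}\Pi_0,\Pi$; if $[\![\Gamma\vdash\Delta]\!]_x=\Lambda\vdash_G\Pi$ then $[\![\Gamma,A\vdash\Delta]\!]_x=\Lambda,x:A\vdash_G\Pi$ and, for fresh $y$ as before, $[\![\Gamma,(\Gamma_0\vdash\Delta_0)\vdash\Delta]\!]_x=\Lambda,\Lambda_0\vdash_{G_0\oplus_y(y,x)\oplus_x G}\Pi_0,\Pi$. (Fresh labels are chosen so all joins are well defined; the result is determined up to renaming of labels other than $x$.) -}

module Defs where

open import Data.Nat using (ℕ; suc; _≡ᵇ_)
open import Data.Bool using (Bool; true; false; if_then_else_)
open import Data.List using (List; []; _∷_; _++_; map)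
open import Data.Product using (_×_; _,_; proj₁; ∃)
open import Data.List.Membership.Propositional using (_∈_; _∉_)
open import Data.List.Relation.Unary.All using (All)
open import Data.List.Relation.Unary.Unique.Propositional using (Unique)
open import Data.List.Relation.Binary.Permutation.Propositional using (_↭_)
open import Relation.Binary.PropositionalEquality using (_≡_)
open import Relation.Nullary using (¬_)
open import Function.Bundles using (_⇔_)

infixr 6 _∧'_
infixr 5 _∨'_
infixr 4 _⊃_ _−<_

data Fml : Set where
  var   : ℕ → Fml
  ⊤'    : Fml
  ⊥'    : Fml
  _∧'_  : Fml → Fml → Fml
  _∨'_  : Fml → Fml → Fml
  _⊃_   : Fml → Fml → Fml
  _−<_  : Fml → Fml → Fml

-- A nested context is a finite multiset of formulas
-- and nested sequents; we represent it as a list and identify lists up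
-- to (recursive) permutation via the relation _≈C_ below.

data Elem : Set where
  fml  : Fml → Elem
  nest : List Elem → List Elem → Elem   -- nest Γ₀ Δ₀  is  (Γ₀ ⊢ Δ₀)

Ctx : Set
Ctx = List Elem

mutual
  data _≈E_ : Elem → Elem → Set where
    fml  : ∀ {A} → fml A ≈E fml A
    nest : ∀ {Γ Γ' Δ Δ'} → Γ ≈C Γ' → Δ ≈C Δ' → nest Γ Δ ≈E nest Γ' Δ'

  data _≈C_ : Ctx → Ctx → Set where
    []    : [] ≈C []
    _∷_   : ∀ {e e' Γ Γ'} → e ≈E e' → Γ ≈C Γ' → (e ∷ Γ) ≈C (e' ∷ Γ')
    swap  : ∀ {e e' Γ} → (e ∷ e' ∷ Γ) ≈C (e' ∷ e ∷ Γ)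
    trans : ∀ {Γ Γ' Γ''} → Γ ≈C Γ' → Γ' ≈C Γ'' → Γ ≈C Γ''

-- Derivability in N-LBiI:  NDeriv Γ Δ  means  Γ ⊢ Δ  is derivable.
-- Principal formulas are written at the head; the rule exch makes the
-- contexts multisets.
data NDeriv : Ctx → Ctx → Set where
  exch    : ∀ {Γ Γ' Δ Δ'} → Γ ≈C Γ' → Δ ≈C Δ' → NDeriv Γ Δ → NDeriv Γ' Δ'
  hyp     : ∀ {Γ Δ A} → NDeriv (fml A ∷ Γ) (fml A ∷ Δ)
  cut     : ∀ {Γ Δ A} → NDeriv Γ (fml A ∷ Δ) → NDeriv (fml A ∷ Γ) Δ → NDeriv Γ Δ
  weakL   : ∀ {Γ Δ A} → NDeriv Γ Δ → NDeriv (fml A ∷ Γ) Δ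
  weakR   : ∀ {Γ Δ A} → NDeriv Γ Δ → NDeriv Γ (fml A ∷ Δ)
  contrL  : ∀ {Γ Δ A} → NDeriv (fml A ∷ fml A ∷ Γ) Δ → NDeriv (fml A ∷ Γ) Δ
  contrR  : ∀ {Γ Δ A} → NDeriv Γ (fml A ∷ fml A ∷ Δ) → NDeriv Γ (fml A ∷ Δ)
  ⊤L      : ∀ {Γ Δ} → NDeriv Γ Δ → NDeriv (fml ⊤' ∷ Γ) Δ
  ⊤R      : ∀ {Γ Δ} → NDeriv Γ (fml ⊤' ∷ Δ)
  ⊥L      : ∀ {Γ Δ} → NDeriv (fml ⊥' ∷ Γ) Δ
  ⊥R      : ∀ {Γ Δ} → NDeriv Γ Δ → NDeriv Γ (fml ⊥' ∷ Δ)
  ∧L      : ∀ {Γ Δ A B} → NDeriv (fml A ∷ fml B ∷ Γ) Δ → NDeriv (fml (A ∧' B) ∷ Γ) Δ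
  ∧R      : ∀ {Γ Δ A B} → NDeriv Γ (fml A ∷ Δ) → NDeriv Γ (fml B ∷ Δ) → NDeriv Γ (fml (A ∧' B) ∷ Δ)
  ∨L      : ∀ {Γ Δ A B} → NDeriv (fml A ∷ Γ) Δ → NDeriv (fml B ∷ Γ) Δ → NDeriv (fml (A ∨' B) ∷ Γ) Δ
  ∨R      : ∀ {Γ Δ A B} → NDeriv Γ (fml A ∷ fml B ∷ Δ) → NDeriv Γ (fml (A ∨' B) ∷ Δ)
  ⊃L      : ∀ {Γ Δ A B} → NDeriv (fml (A ⊃ B) ∷ Γ) (fml A ∷ Δ) → NDeriv (fml B ∷ Γ) Δ
          → NDeriv (fml (A ⊃ B) ∷ Γ) Δ
  ⊃R      : ∀ {Γ Δ A B} → NDeriv (fml A ∷ Γ) (fml B ∷ []) → NDeriv Γ (fml (A ⊃ B) ∷ Δ)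
  −<L     : ∀ {Γ Δ A B} → NDeriv (fml A ∷ []) (fml B ∷ Δ) → NDeriv (fml (A −< B) ∷ Γ) Δ
  −<R     : ∀ {Γ Δ A B} → NDeriv Γ (fml A ∷ Δ) → NDeriv (fml B ∷ Γ) (fml (A −< B) ∷ Δ)
          → NDeriv Γ (fml (A −< B) ∷ Δ)
  nestL   : ∀ {Γ Δ Γ₀ Δ₀} → NDeriv Γ₀ (Δ₀ ++ Δ) → NDeriv (nest Γ₀ Δ₀ ∷ Γ) Δ
  nestR   : ∀ {Γ Δ Γ₀ Δ₀} → NDeriv (Γ ++ Γ₀) Δ₀ → NDeriv Γ (nest Γ₀ Δ₀ ∷ Δ)
  unnestL : ∀ {Γ Δ Γ₀ Δ₀} → NDeriv (nest Γ₀ Δ₀ ∷ Γ) Δ → NDeriv (Γ ++ Γ₀) (Δ₀ ++ Δ)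
  unnestR : ∀ {Γ Δ Γ₀ Δ₀} → NDeriv Γ (nest Γ₀ Δ₀ ∷ Δ) → NDeriv (Γ ++ Γ₀) (Δ₀ ++ Δ)

Label : Set
Label = ℕ

-- A finite directed graph given by its node set and arc set (lists
-- read as sets; see _≅_).
record Graph : Set where
  constructor graph
  field
    nodes : List Label
    arcs  : List (Label × Label)
open Graph public

Arc : Graph → Label → Label → Set
Arc G x y = (x , y) ∈ arcs G

_≅_ : Graph → Graph → Set
G ≅ G' = (∀ z → (z ∈ nodes G) ⇔ (z ∈ nodes G')) × (∀ a → (a ∈ arcs G) ⇔ (a ∈ arcs G'))

single : Label → Graph
single x = graph (x ∷ []) []

arc : Label → Label → Graph
arc x y = graph (x ∷ y ∷ []) ((x , y) ∷ [])

-- union graph; G ⊕ₓ G' is  G ⊕ G'  together with the proviso  Join x G G'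
infixl 5 _⊕_
_⊕_ : Graph → Graph → Graph
G ⊕ G' = graph (nodes G ++ nodes G') (arcs G ++ arcs G')

Join : Label → Graph → Graph → Set
Join x G G' = x ∈ nodes G × x ∈ nodes G' × (∀ z → z ∈ nodes G → z ∈ nodes G' → z ≡ x)

ren : Label → Label → Label → Label
ren y x z = if z ≡ᵇ x then y else z

renG : Label → Label → Graph → Graph
renG y x G = graph (map (ren y x) (nodes G)) (map (λ { (a , b) → ren y x a , ren y x b }) (arcs G))

-- paths of forward/backward arcs.  A step (a , b , d) uses the arc a → b,
-- forwards (from a to b) if d = true, backwards (from b to a) if d = false.
Step : Set
Step = Label × Label × Bool

target : Step → Label
target (a , b , true)  = b
target (a , b , false) = a

data Walk (G : Graph) : Label → Label → List Step → Set where
  stop : ∀ {u} → Walk G u u []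
  fwd  : ∀ {u w v ss} → Arc G u w → Walk G w v ss → Walk G u v ((u , w , true) ∷ ss)
  bwd  : ∀ {u w v ss} → Arc G w u → Walk G w v ss → Walk G u v ((w , u , false) ∷ ss)

visited : Label → List Step → List Label
visited u ss = u ∷ map target ss

IsPath : Graph → Label → Label → List Step → Set
IsPath G u v ss = Walk G u v ss × Unique (visited u ss)

record IsLabelTree (G : Graph) : Set where
  field
    nonempty  : ∃ λ z → z ∈ nodes G
    arcsNodes : ∀ {a b} → Arc G a b → a ∈ nodes G × b ∈ nodes G
    connected : ∀ u v → u ∈ nodes G → v ∈ nodes G → ∃ λ ss → IsPath G u v ss
    uniquePath : ∀ u v ss ss' → IsPath G u v ss → IsPath G u v ss' → ss ≡ ss'

LFml : Set
LFml = Label × Fml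

LCtx : Set
LCtx = List LFml

renC : Label → Label → LCtx → LCtx
renC y x = map (λ { (z , A) → ren y x z , A })

infix 3 _⊢[_]_
record LSeq : Set where
  constructor _⊢[_]_
  field
    lant : LCtx
    tree : Graph
    lsuc : LCtx

WF : LSeq → Set
WF (Γ ⊢[ G ] Δ) = IsLabelTree G × All (λ p → proj₁ p ∈ nodes G) (Γ ++ Δ)

data LRule : List LSeq → LSeq → Set where
  equiv : ∀ {Γ Γ' Δ Δ' G G'} → Γ ↭ Γ' → Δ ↭ Δ' → G ≅ G'
        → LRule ((Γ ⊢[ G ] Δ) ∷ []) (Γ' ⊢[ G' ] Δ')
  hyp   : ∀ {Γ Δ G x A} → LRule [] ((x , A) ∷ Γ ⊢[ G ] (x , A) ∷ Δ)
  cut   : ∀ {Γ Δ G x A} → LRule ((Γ ⊢[ G ] (x , A) ∷ Δ) ∷ ((x , A) ∷ Γ ⊢[ G ] Δ) ∷ []) (Γ ⊢[ G ] Δ)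
  weakL : ∀ {Γ Δ G x A} → LRule ((Γ ⊢[ G ] Δ) ∷ []) ((x , A) ∷ Γ ⊢[ G ] Δ)
  weakR : ∀ {Γ Δ G x A} → LRule ((Γ ⊢[ G ] Δ) ∷ []) (Γ ⊢[ G ] (x , A) ∷ Δ)
  contrL : ∀ {Γ Δ G x A} → LRule (((x , A) ∷ (x , A) ∷ Γ ⊢[ G ] Δ) ∷ []) ((x , A) ∷ Γ ⊢[ G ] Δ)
  contrR : ∀ {Γ Δ G x A} → LRule ((Γ ⊢[ G ] (x , A) ∷ (x , A) ∷ Δ) ∷ []) (Γ ⊢[ G ] (x , A) ∷ Δ)
  nodesplitU : ∀ {Γ Δ G G₀ x y} → (∀ z → ¬ Arc G z x)
        → Join y G₀ (renG y x G) → Join y G₀ (arc y x) → Join x (G₀ ⊕ arc y x) G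
        → LRule ((Γ ⊢[ G₀ ⊕ renG y x G ] Δ) ∷ []) (Γ ⊢[ G₀ ⊕ arc y x ⊕ G ] Δ)
  nodesplitD : ∀ {Γ Δ G G₀ x y} → (∀ z → ¬ Arc G x z)
        → Join y (renG y x G) G₀ → Join x G (arc x y) → Join y (G ⊕ arc x y) G₀
        → LRule ((Γ ⊢[ renG y x G ⊕ G₀ ] Δ) ∷ []) (Γ ⊢[ G ⊕ arc x y ⊕ G₀ ] Δ)
  nodemergeD : ∀ {Γ Δ G G₀ x y}
        → Join y G₀ (arc y x) → Join x (G₀ ⊕ arc y x) G → Join x (renG x y G₀) G
        → LRule ((Γ ⊢[ G₀ ⊕ arc y x ⊕ G ] Δ) ∷ []) (renC x y Γ ⊢[ renG x y G₀ ⊕ G ] renC x y Δ)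
  nodemergeU : ∀ {Γ Δ G G₀ x y}
        → Join x G (arc x y) → Join y (G ⊕ arc x y) G₀ → Join x G (renG x y G₀)
        → LRule ((Γ ⊢[ G ⊕ arc x y ⊕ G₀ ] Δ) ∷ []) (renC x y Γ ⊢[ G ⊕ renG x y G₀ ] renC x y Δ)
  monotL : ∀ {Γ Δ G x y A} → Arc G x y
        → LRule (((x , A) ∷ (y , A) ∷ Γ ⊢[ G ] Δ) ∷ []) ((x , A) ∷ Γ ⊢[ G ] Δ)
  monotR : ∀ {Γ Δ G x y A} → Arc G y x
        → LRule ((Γ ⊢[ G ] (y , A) ∷ (x , A) ∷ Δ) ∷ []) (Γ ⊢[ G ] (x , A) ∷ Δ)
  ⊤L : ∀ {Γ Δ G x} → LRule ((Γ ⊢[ G ] Δ) ∷ []) ((x , ⊤') ∷ Γ ⊢[ G ] Δ)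
  ⊤R : ∀ {Γ Δ G x} → LRule [] (Γ ⊢[ G ] (x , ⊤') ∷ Δ)
  ⊥L : ∀ {Γ Δ G x} → LRule [] ((x , ⊥') ∷ Γ ⊢[ G ] Δ)
  ⊥R : ∀ {Γ Δ G x} → LRule ((Γ ⊢[ G ] Δ) ∷ []) (Γ ⊢[ G ] (x , ⊥') ∷ Δ)
  ∧L : ∀ {Γ Δ G x A B} → LRule (((x , A) ∷ (x , B) ∷ Γ ⊢[ G ] Δ) ∷ []) ((x , A ∧' B) ∷ Γ ⊢[ G ] Δ)
  ∧R : ∀ {Γ Δ G x A B} → LRule ((Γ ⊢[ G ] (x , A) ∷ Δ) ∷ (Γ ⊢[ G ] (x , B) ∷ Δ) ∷ [])
                                (Γ ⊢[ G ] (x , A ∧' B) ∷ Δ)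
  ∨L : ∀ {Γ Δ G x A B} → LRule (((x , A) ∷ Γ ⊢[ G ] Δ) ∷ ((x , B) ∷ Γ ⊢[ G ] Δ) ∷ [])
                                ((x , A ∨' B) ∷ Γ ⊢[ G ] Δ)
  ∨R : ∀ {Γ Δ G x A B} → LRule ((Γ ⊢[ G ] (x , A) ∷ (x , B) ∷ Δ) ∷ []) (Γ ⊢[ G ] (x , A ∨' B) ∷ Δ)
  ⊃L : ∀ {Γ Δ G x A B} → LRule (((x , A ⊃ B) ∷ Γ ⊢[ G ] (x , A) ∷ Δ) ∷ ((x , B) ∷ Γ ⊢[ G ] Δ) ∷ [])
                                ((x , A ⊃ B) ∷ Γ ⊢[ G ] Δ)
  ⊃R : ∀ {Γ Δ G x y A B} → y ∉ nodes G → Join x G (arc x y)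
        → LRule (((y , A) ∷ Γ ⊢[ G ⊕ arc x y ] (y , B) ∷ Δ) ∷ []) (Γ ⊢[ G ] (x , A ⊃ B) ∷ Δ)
  −<L : ∀ {Γ Δ G x y A B} → y ∉ nodes G → Join x (arc y x) G
        → LRule (((y , A) ∷ Γ ⊢[ arc y x ⊕ G ] (y , B) ∷ Δ) ∷ []) ((x , A −< B) ∷ Γ ⊢[ G ] Δ)
  −<R : ∀ {Γ Δ G x A B} → LRule ((Γ ⊢[ G ] (x , A) ∷ Δ) ∷ ((x , B) ∷ Γ ⊢[ G ] (x , A −< B) ∷ Δ) ∷ [])
                                (Γ ⊢[ G ] (x , A −< B) ∷ Δ)

data LDeriv : LSeq → Set where
  by : ∀ {ps s} → LRule ps s → WF s → All LDeriv ps → LDeriv s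

-- Translation [[ Γ ⊢ Δ ]]ₓ.  Fresh labels are drawn from a counter.

record TR : Set where
  constructor tr
  field
    Λ    : LCtx
    Gr   : Graph
    Π    : LCtx
    next : ℕ
open TR

mutual
  trR : Ctx → Label → ℕ → TR
  trR [] x n = tr [] (single x) [] n
  trR (fml A ∷ Δ) x n = let r = trR Δ x n in tr (Λ r) (Gr r) ((x , A) ∷ Π r) (next r)
  trR (nest Γ₀ Δ₀ ∷ Δ) x n =
    let r = trR Δ x n ; y = next r ; r₀ = trL Γ₀ Δ₀ y (suc y)
    in tr (Λ r ++ Λ r₀) (Gr r ⊕ arc x y ⊕ Gr r₀) (Π r₀ ++ Π r) (next r₀)

  trL : Ctx → Ctx → Label → ℕ → TR
  trL [] Δ x n = trR Δ x n
  trL (fml A ∷ Γ) Δ x n = let r = trL Γ Δ x n in tr ((x , A) ∷ Λ r) (Gr r) (Π r) (next r)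
  trL (nest Γ₀ Δ₀ ∷ Γ) Δ x n =
    let r = trL Γ Δ x n ; y = next r ; r₀ = trL Γ₀ Δ₀ y (suc y)
    in tr (Λ r ++ Λ r₀) (Gr r₀ ⊕ arc y x ⊕ Gr r) (Π r₀ ++ Π r) (next r₀)

⟦_⊢_⟧ : Ctx → Ctx → Label → LSeq
⟦ Γ ⊢ Δ ⟧ x = let r = trL Γ Δ x (suc x) in Λ r ⊢[ Gr r ] Π r

-- The proof is by induction on the N-LBiI derivation, for a more flexible
-- invariant than ⟦_⊢_⟧: the relation Transl lets the fresh labels be chosen
-- freely and takes labelled sequents up to permutation of formulas and set
-- equality of trees.  A translation can be inverted at any element of either
-- side, so exchange is harmless and every N-LBiI rule acting on formulas is the
-- same L-LBiI rule at the root.  For the structural rules a translation is split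
-- at its root into the parts coming from the two sides and from the nested
-- sequents.  nestL and nestR translate their premise at the root of the nested
-- sequent, with the other side grafted on by renaming the root, and recover the
-- conclusion by nodesplit, monotonicity and weakening; ⊃R and −<L are the
-- special case of the nested sequent A ⊢ B.  unnestL and unnestR re-root the
-- unnested part at a fresh label and merge it back by nodemerge.  Finally
-- ⟦_⊢_⟧ x is itself a translation, since its counter keeps all fresh labels
-- apart.

module Submission where

open import Defs
open import Data.Nat using (ℕ; suc; _≡ᵇ_; _≟_; _<_; _≤_; _⊔_)
open import Data.Nat.Properties using (≡ᵇ⇒≡; ≡⇒≡ᵇ; <-≤-trans; <-trans; n≤1+n; <-irrefl; ≤-refl; ≤-trans; m≤m⊔n; m≤n⊔m; n<1+n)
open import Data.Bool using (true; false; T)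
open import Data.List using (List; []; _∷_; _++_; map; foldr)
open import Data.List.Properties using (map-++; map-∘; map-id-local; ++-assoc; ++-identityʳ)
open import Data.Product using (_×_; _,_; proj₁; proj₂; ∃; Σ)
open import Data.Sum using (_⊎_; inj₁; inj₂; [_,_]′) renaming (swap to ⊎-swap)
open import Data.Empty using (⊥; ⊥-elim)
open import Data.Unit using (tt)
open import Data.List.Membership.Propositional using (_∈_; _∉_)
open import Data.List.Membership.Propositional.Properties using (∈-++⁺ˡ; ∈-++⁺ʳ; ∈-++⁻; ∈-map⁺; ∈-map⁻)
open import Data.List.Relation.Unary.Any using (here; there)
open import Data.List.Relation.Unary.All as All using (All; []; _∷_)
open import Data.List.Relation.Unary.All.Properties using (All¬⇒¬Any; ¬Any⇒All¬; map⁺)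
  renaming (++⁺ to All-++⁺; ++⁻ˡ to All-++⁻ˡ; ++⁻ʳ to All-++⁻ʳ)
open import Data.List.Relation.Unary.Unique.Propositional using (Unique)
import Data.List.Relation.Unary.Unique.Propositional.Properties as Unique
open import Data.List.Relation.Unary.AllPairs as AllPairs using ([]; _∷_)
open import Data.List.Relation.Binary.BagAndSetEquality using (_∼[_]_; set; commutativeMonoid)
open import Data.List.Relation.Binary.Permutation.Propositional using (_↭_; ↭-refl; ↭-sym; ↭-trans; prep; ↭-swap; ↭-reflexive)
import Data.List.Relation.Binary.Permutation.Propositional.Properties as ↭
open import Relation.Binary.PropositionalEquality using (_≡_; refl; sym; cong; cong₂; subst; _≢_) renaming (trans to ≡-trans)
open import Relation.Nullary using (¬_; yes; no; Dec)
open import Function.Bundles using (mk⇔; Equivalence)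
open import Level using (0ℓ)
open import Algebra.Bundles using (CommutativeMonoid)
import Algebra.Solver.CommutativeMonoid as CMSolver
import Algebra.Properties.CommutativeSemigroup as CommutativeSemigroupProperties

open Equivalence using (to; from)

module SetEq {A : Set} = CommutativeMonoid (commutativeMonoid set A)

≅-intro : ∀ {G H} → nodes G ∼[ set ] nodes H → arcs G ∼[ set ] arcs H → G ≅ H
≅-intro n a = (λ _ → n) , (λ _ → a)

≅-nodes : ∀ {G H} → G ≅ H → nodes G ∼[ set ] nodes H
≅-nodes (n , _) {z} = n z

≅-arcs : ∀ {G H} → G ≅ H → arcs G ∼[ set ] arcs H
≅-arcs (_ , a) {z} = a z

≅⇒⊆ : ∀ {G H z} → G ≅ H → z ∈ nodes G → z ∈ nodes H
≅⇒⊆ e = to (≅-nodes e)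

≅-refl : ∀ {G} → G ≅ G
≅-refl = ≅-intro SetEq.refl SetEq.refl

≅-sym : ∀ {G H} → G ≅ H → H ≅ G
≅-sym e = ≅-intro (SetEq.sym (≅-nodes e)) (SetEq.sym (≅-arcs e))

≅-trans : ∀ {G H K} → G ≅ H → H ≅ K → G ≅ K
≅-trans e f = ≅-intro (SetEq.trans (≅-nodes e) (≅-nodes f)) (SetEq.trans (≅-arcs e) (≅-arcs f))

⊕-cong : ∀ {G G' H H'} → G ≅ G' → H ≅ H' → (G ⊕ H) ≅ (G' ⊕ H')
⊕-cong e f = ≅-intro (SetEq.∙-cong (≅-nodes e) (≅-nodes f)) (SetEq.∙-cong (≅-arcs e) (≅-arcs f))

emptyGraph : Graph
emptyGraph = graph [] []

⊕-commutativeMonoid : CommutativeMonoid 0ℓ 0ℓ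
⊕-commutativeMonoid = record
  { Carrier = Graph ; _≈_ = _≅_ ; _∙_ = _⊕_ ; ε = emptyGraph
  ; isCommutativeMonoid = record
    { isMonoid = record
      { isSemigroup = record
        { isMagma = record
          { isEquivalence = record { refl = ≅-refl ; sym = ≅-sym ; trans = ≅-trans }
          ; ∙-cong = ⊕-cong }
        ; assoc = λ G H K → ≅-intro (SetEq.assoc (nodes G) (nodes H) (nodes K)) (SetEq.assoc (arcs G) (arcs H) (arcs K)) }
      ; identity = (λ _ → ≅-refl) , (λ G → ≅-intro (SetEq.identityʳ (nodes G)) (SetEq.identityʳ (arcs G))) }
    ; comm = λ G H → ≅-intro (SetEq.comm (nodes G) (nodes H)) (SetEq.comm (arcs G) (arcs H)) } }

open CMSolver ⊕-commutativeMonoid using (solve; _⊜_) renaming (_⊕_ to _⊛_)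
module Perm = CommutativeSemigroupProperties (CommutativeMonoid.commutativeSemigroup (↭.++-commutativeMonoid {A = LFml}))

⊕-comm : ∀ G H → (G ⊕ H) ≅ (H ⊕ G)
⊕-comm = CommutativeMonoid.comm ⊕-commutativeMonoid

single-absorbˡ : ∀ {x G} → x ∈ nodes G → (single x ⊕ G) ≅ G
single-absorbˡ m = ≅-intro (mk⇔ (λ { (here refl) → m ; (there q) → q }) there) SetEq.refl

single-absorbʳ : ∀ {x G} → x ∈ nodes G → (G ⊕ single x) ≅ G
single-absorbʳ {x} {G} m = ≅-trans (⊕-comm G (single x)) (single-absorbˡ m)

∈-⊕ˡ : ∀ {z} G H → z ∈ nodes G → z ∈ nodes (G ⊕ H)
∈-⊕ˡ G H = ∈-++⁺ˡ

∈-⊕ʳ : ∀ {z} G H → z ∈ nodes H → z ∈ nodes (G ⊕ H)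
∈-⊕ʳ G H = ∈-++⁺ʳ (nodes G)

ArcsIn : Graph → Set
ArcsIn G = ∀ {a b} → Arc G a b → a ∈ nodes G × b ∈ nodes G

walk-map : ∀ {G H u v ss} → (∀ {a b} → Arc G a b → Arc H a b) → Walk G u v ss → Walk H u v ss
walk-map f stop = stop
walk-map f (fwd a w) = fwd (f a) (walk-map f w)
walk-map f (bwd a w) = bwd (f a) (walk-map f w)

walk-end : ∀ {G u v ss} → Walk G u v ss → v ∈ visited u ss
walk-end stop = here refl
walk-end (fwd a w) = there (walk-end w)
walk-end (bwd a w) = there (walk-end w)

walk-start : ∀ {G u v s ss} → ArcsIn G → Walk G u v (s ∷ ss) → u ∈ nodes G
walk-start an (fwd a w) = proj₁ (an a)
walk-start an (bwd a w) = proj₂ (an a)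

walk-++ : ∀ {G u v w ss ts} → Walk G u v ss → Walk G v w ts → Walk G u w (ss ++ ts)
walk-++ stop q = q
walk-++ (fwd a p) q = fwd a (walk-++ p q)
walk-++ (bwd a p) q = bwd a (walk-++ p q)

walk-⊆ : ∀ {G u v ss} → ArcsIn G → Walk G u v ss → u ∈ nodes G → ∀ {z} → z ∈ visited u ss → z ∈ nodes G
walk-⊆ aG w m (here refl) = m
walk-⊆ aG (fwd a w) m (there q) = walk-⊆ aG w (proj₂ (aG a)) q
walk-⊆ aG (bwd a w) m (there q) = walk-⊆ aG w (proj₁ (aG a)) q

visited-++ : ∀ d s1 s2 {z} → z ∈ visited d s1 → z ∈ visited d (s1 ++ s2)
visited-++ d s1 s2 (here e) = here e
visited-++ d s1 s2 (there q) rewrite map-++ target s1 s2 = there (∈-++⁺ˡ q)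

Unique-head : ∀ {A : Set} {x : A} {xs} → Unique (x ∷ xs) → x ∉ xs
Unique-head u = All¬⇒¬Any (AllPairs.head u)

Unique-cons : ∀ {A : Set} {x : A} {xs} → x ∉ xs → Unique xs → Unique (x ∷ xs)
Unique-cons n u = ¬Any⇒All¬ _ n ∷ u

tree-≅ : ∀ {G H} → G ≅ H → IsLabelTree G → IsLabelTree H
tree-≅ {G} {H} e t = record
  { nonempty = let (z , m) = nonempty in z , to (≅-nodes e) m
  ; arcsNodes = λ a → let (p , q) = arcsNodes (from (≅-arcs e) a) in to (≅-nodes e) p , to (≅-nodes e) q
  ; connected = λ u v mu mv →
      let (ss , w , un) = connected u v (from (≅-nodes e) mu) (from (≅-nodes e) mv)
      in ss , walk-map (to (≅-arcs e)) w , un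
  ; uniquePath = λ u v ss ss' (w , un) (w' , un') →
      uniquePath u v ss ss' (walk-map (from (≅-arcs e)) w , un) (walk-map (from (≅-arcs e)) w' , un')
  }
  where open IsLabelTree t

single-walk : ∀ {x u v ss} → Walk (single x) u v ss → ss ≡ []
single-walk stop = refl
single-walk (fwd () w)
single-walk (bwd () w)

single-tree : ∀ x → IsLabelTree (single x)
single-tree x = record
  { nonempty = x , here refl
  ; arcsNodes = λ ()
  ; connected = λ { u v (here refl) (here refl) → [] , stop , ([] ∷ []) }
  ; uniquePath = λ u v ss ss' (w , _) (w' , _) → ≡-trans (single-walk w) (sym (single-walk w'))
  }

module ArcTree (a b : Label) (a≢b : a ≢ b) where
  ArcPath : Label → Label → List Step → Set
  ArcPath u v ss = (ss ≡ [] × u ≡ v) ⊎ (ss ≡ (a , b , true) ∷ [] × u ≡ a × v ≡ b)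
                 ⊎ (ss ≡ (a , b , false) ∷ [] × u ≡ b × v ≡ a)

  arcPath : ∀ {u v ss} → IsPath (arc a b) u v ss → ArcPath u v ss
  arcPath (stop , _) = inj₁ (refl , refl)
  arcPath (fwd (here refl) stop , _) = inj₂ (inj₁ (refl , refl , refl))
  arcPath (fwd (here refl) (fwd (here refl) w) , _) = ⊥-elim (a≢b refl)
  arcPath (fwd (here refl) (bwd (here refl) w) , un) = ⊥-elim (Unique-head un (there (here refl)))
  arcPath (bwd (here refl) stop , _) = inj₂ (inj₂ (refl , refl , refl))
  arcPath (bwd (here refl) (fwd (here refl) w) , un) = ⊥-elim (Unique-head un (there (here refl)))
  arcPath (bwd (here refl) (bwd (here refl) w) , _) = ⊥-elim (a≢b refl)
  arcPath (fwd (there ()) w , _)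
  arcPath (bwd (there ()) w , _)

  arcPath-unique : ∀ {u v ss ss'} → ArcPath u v ss → ArcPath u v ss' → ss ≡ ss'
  arcPath-unique (inj₁ (refl , _)) (inj₁ (refl , _)) = refl
  arcPath-unique (inj₁ (_ , refl)) (inj₂ (inj₁ (_ , refl , refl))) = ⊥-elim (a≢b refl)
  arcPath-unique (inj₁ (_ , refl)) (inj₂ (inj₂ (_ , refl , refl))) = ⊥-elim (a≢b refl)
  arcPath-unique (inj₂ (inj₁ (_ , refl , refl))) (inj₁ (_ , refl)) = ⊥-elim (a≢b refl)
  arcPath-unique (inj₂ (inj₁ (refl , _))) (inj₂ (inj₁ (refl , _))) = refl
  arcPath-unique (inj₂ (inj₁ (_ , refl , refl))) (inj₂ (inj₂ (_ , refl , _))) = ⊥-elim (a≢b refl)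
  arcPath-unique (inj₂ (inj₂ (_ , refl , refl))) (inj₁ (_ , refl)) = ⊥-elim (a≢b refl)
  arcPath-unique (inj₂ (inj₂ (_ , refl , refl))) (inj₂ (inj₁ (_ , refl , _))) = ⊥-elim (a≢b refl)
  arcPath-unique (inj₂ (inj₂ (refl , _))) (inj₂ (inj₂ (refl , _))) = refl

  arc-tree : IsLabelTree (arc a b)
  arc-tree = record
    { nonempty = a , here refl
    ; arcsNodes = λ { (here refl) → here refl , there (here refl) ; (there ()) }
    ; connected = connected
    ; uniquePath = λ u v ss ss' P P' → arcPath-unique (arcPath P) (arcPath P')
    }
    where
    connected : ∀ u v → u ∈ nodes (arc a b) → v ∈ nodes (arc a b) → ∃ λ ss → IsPath (arc a b) u v ss
    connected u v (here refl) (here refl) = [] , stop , ([] ∷ [])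
    connected u v (here refl) (there (here refl)) = _ , fwd (here refl) stop , Unique-cons (λ { (here e) → a≢b e ; (there ()) }) ([] ∷ [])
    connected u v (there (here refl)) (here refl) = _ , bwd (here refl) stop , Unique-cons (λ { (here e) → a≢b (sym e) ; (there ()) }) ([] ∷ [])
    connected u v (there (here refl)) (there (here refl)) = [] , stop , ([] ∷ [])
    connected u v _ (there (there ()))
    connected u v (there (there ())) _

-- Two trees meeting in exactly one node x form a tree: a path that leaves
-- one of them can only come back through x, which it may visit only once.
module JoinPaths (G H K : Graph) (x : Label)
  (split : ∀ {a b} → Arc K a b → Arc G a b ⊎ Arc H a b)
  (inG : ∀ {a b} → Arc G a b → Arc K a b) (inH : ∀ {a b} → Arc H a b → Arc K a b)
  (aG : ArcsIn G) (aH : ArcsIn H)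
  (meet : ∀ z → z ∈ nodes G → z ∈ nodes H → z ≡ x) where

  walk-staysIn : ∀ {d v ss} → Walk K d v ss → d ∈ nodes H → x ∉ visited d ss → Walk H d v ss
  walk-staysIn stop _ _ = stop
  walk-staysIn (fwd a w) m n with split a
  ... | inj₁ g = ⊥-elim (n (here (sym (meet _ (proj₁ (aG g)) m))))
  ... | inj₂ h = fwd h (walk-staysIn w (proj₂ (aH h)) (λ q → n (there q)))
  walk-staysIn (bwd a w) m n with split a
  ... | inj₁ g = ⊥-elim (n (here (sym (meet _ (proj₂ (aG g)) m))))
  ... | inj₂ h = bwd h (walk-staysIn w (proj₁ (aH h)) (λ q → n (there q)))

  noReturn : ∀ {u d v rest} → u ∈ nodes H → d ∈ nodes H → Walk K d v rest → u ∈ nodes G → v ∈ nodes G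
           → ¬ Unique (u ∷ visited d rest)
  noReturn uH dH w uG vG un with meet _ uG uH
  ... | refl = let wH = walk-staysIn w dH (Unique-head un)
                   vH = walk-⊆ aH wH dH (walk-end wH)
               in Unique-head un (subst (_∈ _) (meet _ vG vH) (walk-end w))

  pathWithin : ∀ {u v ss} → Walk K u v ss → u ∈ nodes G → v ∈ nodes G → Unique (visited u ss) → Walk G u v ss
  pathWithin stop _ _ _ = stop
  pathWithin (fwd a w) mu mv un with split a
  ... | inj₁ g = fwd g (pathWithin w (proj₂ (aG g)) mv (AllPairs.tail un))
  ... | inj₂ h = ⊥-elim (noReturn (proj₁ (aH h)) (proj₂ (aH h)) w mu mv un)
  pathWithin (bwd a w) mu mv un with split a
  ... | inj₁ g = bwd g (pathWithin w (proj₁ (aG g)) mv (AllPairs.tail un))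
  ... | inj₂ h = ⊥-elim (noReturn (proj₂ (aH h)) (proj₁ (aH h)) w mu mv un)

  PathVia : Label → Label → List Step → Set
  PathVia u v ss = Σ (List Step) λ s1 → Σ (List Step) λ s2 → ss ≡ s1 ++ s2 × IsPath G u x s1 × IsPath H x v s2

  pathAcross : ∀ {u v ss} → Walk K u v ss → u ∈ nodes G → v ∈ nodes H → Unique (visited u ss) → PathVia u v ss
  pathAcross stop mu mv un with meet _ mu mv
  ... | refl = [] , [] , refl , (stop , [] ∷ []) , (stop , [] ∷ [])
  pathAcross (fwd {w = d} a w) mu mv un with split a
  ... | inj₁ g = let (s1 , s2 , eq , (W1 , U1) , P2) = pathAcross w (proj₂ (aG g)) mv (AllPairs.tail un)
                 in _ , s2 , cong (_ ∷_) eq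
                    , (fwd g W1 , Unique-cons (λ q → Unique-head un (subst (λ r → _ ∈ visited d r) (sym eq) (visited-++ d s1 s2 q))) U1)
                    , P2
  ... | inj₂ h with meet _ mu (proj₁ (aH h))
  ...   | refl = [] , _ , refl , (stop , [] ∷ []) , (fwd h (walk-staysIn w (proj₂ (aH h)) (Unique-head un)) , un)
  pathAcross (bwd {w = d} a w) mu mv un with split a
  ... | inj₁ g = let (s1 , s2 , eq , (W1 , U1) , P2) = pathAcross w (proj₁ (aG g)) mv (AllPairs.tail un)
                 in _ , s2 , cong (_ ∷_) eq
                    , (bwd g W1 , Unique-cons (λ q → Unique-head un (subst (λ r → _ ∈ visited d r) (sym eq) (visited-++ d s1 s2 q))) U1)
                    , P2
  ... | inj₂ h with meet _ mu (proj₂ (aH h))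
  ...   | refl = [] , _ , refl , (stop , [] ∷ []) , (bwd h (walk-staysIn w (proj₁ (aH h)) (Unique-head un)) , un)

  path-++ : ∀ {u v s1 s2} → u ∈ nodes G → x ∈ nodes H → IsPath G u x s1 → IsPath H x v s2 → IsPath K u v (s1 ++ s2)
  path-++ {u} {v} {s1} {s2} mu xH (W1 , U1) (W2 , U2) = walk-++ (walk-map inG W1) (walk-map inH W2) , unique
    where
    unique : Unique (visited u (s1 ++ s2))
    unique rewrite map-++ target s1 s2 = Unique.++⁺ U1 (AllPairs.tail U2) disjoint
      where
      disjoint : ∀ {z} → ¬ (z ∈ visited u s1 × z ∈ map target s2)
      disjoint (p , q) = Unique-head U2 (subst (_∈ map target s2)
                           (meet _ (walk-⊆ aG W1 mu p) (walk-⊆ aH W2 xH (there q))) q)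

joinTree : ∀ {G H x} → IsLabelTree G → IsLabelTree H → Join x G H → IsLabelTree (G ⊕ H)
joinTree {G} {H} {x} tG tH (xG , xH , meet) = record
  { nonempty = x , ∈-++⁺ˡ xG
  ; arcsNodes = arcsNodes
  ; connected = connected
  ; uniquePath = uniquePath
  }
  where
  module TG = IsLabelTree tG
  module TH = IsLabelTree tH
  inG : ∀ {a b} → Arc G a b → Arc (G ⊕ H) a b
  inG = ∈-++⁺ˡ
  inH : ∀ {a b} → Arc H a b → Arc (G ⊕ H) a b
  inH = ∈-++⁺ʳ (arcs G)
  module GH = JoinPaths G H (G ⊕ H) x (∈-++⁻ (arcs G)) inG inH TG.arcsNodes TH.arcsNodes meet
  module HG = JoinPaths H G (G ⊕ H) x (λ a → ⊎-swap (∈-++⁻ (arcs G) a)) inH inG TH.arcsNodes TG.arcsNodes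
                        (λ z p q → meet z q p)
  arcsNodes : ArcsIn (G ⊕ H)
  arcsNodes a with ∈-++⁻ (arcs G) a
  ... | inj₁ g = let (p , q) = TG.arcsNodes g in ∈-++⁺ˡ p , ∈-++⁺ˡ q
  ... | inj₂ h = let (p , q) = TH.arcsNodes h in ∈-++⁺ʳ (nodes G) p , ∈-++⁺ʳ (nodes G) q
  connected : ∀ u v → u ∈ nodes (G ⊕ H) → v ∈ nodes (G ⊕ H) → ∃ λ ss → IsPath (G ⊕ H) u v ss
  connected u v mu mv with ∈-++⁻ (nodes G) mu | ∈-++⁻ (nodes G) mv
  ... | inj₁ p | inj₁ q = let (ss , w , un) = TG.connected u v p q in ss , walk-map inG w , un
  ... | inj₂ p | inj₂ q = let (ss , w , un) = TH.connected u v p q in ss , walk-map inH w , un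
  ... | inj₁ p | inj₂ q = _ , GH.path-++ p xH (proj₂ (TG.connected u x p xG)) (proj₂ (TH.connected x v xH q))
  ... | inj₂ p | inj₁ q = _ , HG.path-++ p xG (proj₂ (TH.connected u x p xH)) (proj₂ (TG.connected x v xG q))
  uniqueFrom : ∀ u v ss ss' → u ∈ nodes (G ⊕ H) → IsPath (G ⊕ H) u v ss → IsPath (G ⊕ H) u v ss' → ss ≡ ss'
  uniqueFrom u v ss ss' mu (w , un) (w' , un') with ∈-++⁻ (nodes G) mu | ∈-++⁻ (nodes G) (walk-⊆ arcsNodes w mu (walk-end w))
  ... | inj₁ p | inj₁ q = TG.uniquePath u v ss ss' (GH.pathWithin w p q un , un) (GH.pathWithin w' p q un' , un')
  ... | inj₂ p | inj₂ q = TH.uniquePath u v ss ss' (HG.pathWithin w p q un , un) (HG.pathWithin w' p q un' , un')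
  ... | inj₁ p | inj₂ q = let (s1 , s2 , e , P1 , P2) = GH.pathAcross w p q un
                              (s1' , s2' , e' , P1' , P2') = GH.pathAcross w' p q un'
                          in ≡-trans e (≡-trans (cong₂ _++_ (TG.uniquePath u x s1 s1' P1 P1')
                                                           (TH.uniquePath x v s2 s2' P2 P2')) (sym e'))
  ... | inj₂ p | inj₁ q = let (s1 , s2 , e , P1 , P2) = HG.pathAcross w p q un
                              (s1' , s2' , e' , P1' , P2') = HG.pathAcross w' p q un'
                          in ≡-trans e (≡-trans (cong₂ _++_ (TH.uniquePath u x s1 s1' P1 P1')
                                                           (TG.uniquePath x v s2 s2' P2 P2')) (sym e'))
  uniquePath : ∀ u v ss ss' → IsPath (G ⊕ H) u v ss → IsPath (G ⊕ H) u v ss' → ss ≡ ss'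
  uniquePath u v [] [] _ _ = refl
  uniquePath u v (s ∷ ss) ss' P P' = uniqueFrom u v _ ss' (walk-start arcsNodes (proj₁ P)) P P'
  uniquePath u v [] (s ∷ ss') P P' = uniqueFrom u v [] _ (walk-start arcsNodes (proj₁ P')) P P'

record Disjoint (G H : Graph) : Set where
  constructor disjoint
  field disjoint-∉ : ∀ z → z ∈ nodes G → z ∈ nodes H → ⊥
open Disjoint public

Disjoint-sym : ∀ {G H} → Disjoint G H → Disjoint H G
Disjoint-sym d = disjoint λ z p q → disjoint-∉ d z q p

Disjoint-≅ : ∀ {G G' H} → G ≅ G' → Disjoint G H → Disjoint G' H
Disjoint-≅ e d = disjoint λ z p q → disjoint-∉ d z (≅⇒⊆ (≅-sym e) p) q

Disjoint-⊕ : ∀ {G G' H} → Disjoint G H → Disjoint G' H → Disjoint (G ⊕ G') H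
Disjoint-⊕ {G} d d' = disjoint λ z p q → [ (λ r → disjoint-∉ d z r q) , (λ r → disjoint-∉ d' z r q) ]′ (∈-++⁻ (nodes G) p)

Disjoint-⊕⁻ˡ : ∀ {G G' H} → Disjoint (G ⊕ G') H → Disjoint G H
Disjoint-⊕⁻ˡ d = disjoint λ z p q → disjoint-∉ d z (∈-++⁺ˡ p) q

Disjoint-⊕⁻ʳ : ∀ {G G' H} → Disjoint (G ⊕ G') H → Disjoint G' H
Disjoint-⊕⁻ʳ {G} d = disjoint λ z p q → disjoint-∉ d z (∈-++⁺ʳ (nodes G) p) q

Disjoint-arc : ∀ {a b H} → a ∉ nodes H → b ∉ nodes H → Disjoint (arc a b) H
Disjoint-arc na nb = disjoint λ { z (here refl) q → na q ; z (there (here refl)) q → nb q ; z (there (there ())) q }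

Disjoint-single : ∀ {y H} → y ∉ nodes H → Disjoint (single y) H
Disjoint-single n = disjoint λ { z (here refl) q → n q ; z (there ()) q }

Disjoint-∉ˡ : ∀ {G H z} → Disjoint G H → z ∈ nodes G → z ∉ nodes H
Disjoint-∉ˡ d p q = disjoint-∉ d _ p q

Disjoint-∉ʳ : ∀ {G H z} → Disjoint G H → z ∈ nodes H → z ∉ nodes G
Disjoint-∉ʳ d p q = disjoint-∉ d _ q p

bridgeTree : ∀ {G H a b} → IsLabelTree G → IsLabelTree H → Disjoint G H → a ∈ nodes G → b ∈ nodes H
           → IsLabelTree (G ⊕ arc a b ⊕ H)
bridgeTree {G} {H} {a} {b} tG tH d aG bH =
  joinTree (joinTree tG (ArcTree.arc-tree a b a≢b) (aG , here refl , meetG)) tH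
           (∈-++⁺ʳ (nodes G) (there (here refl)) , bH , meetH)
  where
  a≢b : a ≢ b
  a≢b refl = disjoint-∉ d a aG bH
  meetG : ∀ z → z ∈ nodes G → z ∈ nodes (arc a b) → z ≡ a
  meetG z p (here e) = e
  meetG z p (there (here refl)) = ⊥-elim (disjoint-∉ d z p bH)
  meetH : ∀ z → z ∈ nodes (G ⊕ arc a b) → z ∈ nodes H → z ≡ b
  meetH z p q with ∈-++⁻ (nodes G) p
  ... | inj₁ r = ⊥-elim (disjoint-∉ d z r q)
  ... | inj₂ (here refl) = ⊥-elim (disjoint-∉ d z aG q)
  ... | inj₂ (there (here e)) = e

-- Transl Γ Δ x s: s is a translation of Γ ⊢ Δ rooted at x, for some choice of
-- fresh labels.  Unlike ⟦_⊢_⟧ this is stable under exchange, renaming and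
-- splitting of contexts, which is what the induction needs.
mutual
  data Transl : Ctx → Ctx → Label → LSeq → Set where
    empty : ∀ {x} → Transl [] [] x ([] ⊢[ single x ] [])
    consL : ∀ {e Γ Δ x s s'} → Transl Γ Δ x s → ExtL e x s s' → Transl (e ∷ Γ) Δ x s'
    consR : ∀ {e Γ Δ x s s'} → Transl Γ Δ x s → ExtR e x s s' → Transl Γ (e ∷ Δ) x s'

  data ExtL : Elem → Label → LSeq → LSeq → Set where
    formula : ∀ {A x Λ G Π} → ExtL (fml A) x (Λ ⊢[ G ] Π) ((x , A) ∷ Λ ⊢[ G ] Π)
    nested  : ∀ {Γ₀ Δ₀ x y Λ G Π Λ₀ G₀ Π₀} → Transl Γ₀ Δ₀ y (Λ₀ ⊢[ G₀ ] Π₀) → Disjoint G G₀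
            → ExtL (nest Γ₀ Δ₀) x (Λ ⊢[ G ] Π) (Λ ++ Λ₀ ⊢[ G₀ ⊕ arc y x ⊕ G ] Π₀ ++ Π)

  data ExtR : Elem → Label → LSeq → LSeq → Set where
    formula : ∀ {A x Λ G Π} → ExtR (fml A) x (Λ ⊢[ G ] Π) (Λ ⊢[ G ] (x , A) ∷ Π)
    nested  : ∀ {Γ₀ Δ₀ x y Λ G Π Λ₀ G₀ Π₀} → Transl Γ₀ Δ₀ y (Λ₀ ⊢[ G₀ ] Π₀) → Disjoint G G₀
            → ExtR (nest Γ₀ Δ₀) x (Λ ⊢[ G ] Π) (Λ ++ Λ₀ ⊢[ G ⊕ arc x y ⊕ G₀ ] Π₀ ++ Π)

LabelsIn : LCtx → Graph → Set
LabelsIn L G = All (λ p → proj₁ p ∈ nodes G) L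

record WellFormed (s : LSeq) : Set where
  constructor wellFormed
  field
    isTree    : IsLabelTree (LSeq.tree s)
    antLabels : LabelsIn (LSeq.lant s) (LSeq.tree s)
    sucLabels : LabelsIn (LSeq.lsuc s) (LSeq.tree s)
open WellFormed public

WellFormed⇒WF : ∀ {s} → WellFormed s → WF s
WellFormed⇒WF (wellFormed t l r) = t , All-++⁺ l r

WF⇒WellFormed : ∀ {s} → WF s → WellFormed s
WF⇒WellFormed {Λ ⊢[ G ] Π} (t , ls) = wellFormed t (All-++⁻ˡ Λ ls) (All-++⁻ʳ Λ ls)

LDeriv-wf : ∀ {s} → LDeriv s → WellFormed s
LDeriv-wf (by r w ds) = WF⇒WellFormed w

LabelsIn-≅ : ∀ {G G' L} → G ≅ G' → LabelsIn L G → LabelsIn L G'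
LabelsIn-≅ e = All.map (≅⇒⊆ e)

infix 2 _∼_
_∼_ : LSeq → LSeq → Set
s ∼ s' = (LSeq.lant s ↭ LSeq.lant s') × (LSeq.tree s ≅ LSeq.tree s') × (LSeq.lsuc s ↭ LSeq.lsuc s')

∼-refl : ∀ {s} → s ∼ s
∼-refl = ↭-refl , ≅-refl , ↭-refl

∼-sym : ∀ {s s'} → s ∼ s' → s' ∼ s
∼-sym (a , b , c) = ↭-sym a , ≅-sym b , ↭-sym c

∼-trans : ∀ {s s' s''} → s ∼ s' → s' ∼ s'' → s ∼ s''
∼-trans (a , b , c) (a' , b' , c') = ↭-trans a a' , ≅-trans b b' , ↭-trans c c'

≡⇒∼ : ∀ {s s'} → s ≡ s' → s ∼ s'
≡⇒∼ refl = ∼-refl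

WellFormed-∼ : ∀ {s s'} → s ∼ s' → WellFormed s → WellFormed s'
WellFormed-∼ (a , b , c) (wellFormed t l r) =
  wellFormed (tree-≅ b t) (LabelsIn-≅ b (↭.All-resp-↭ a l)) (LabelsIn-≅ b (↭.All-resp-↭ c r))

LDeriv-∼ : ∀ {s s'} → LDeriv s → s ∼ s' → LDeriv s'
LDeriv-∼ D e = by (equiv (proj₁ e) (proj₂ (proj₂ e)) (proj₁ (proj₂ e))) (WellFormed⇒WF (WellFormed-∼ e (LDeriv-wf D))) (D ∷ [])

Transl-wf : ∀ {Γ Δ x s} → Transl Γ Δ x s → WellFormed s × x ∈ nodes (LSeq.tree s)
Transl-wf empty = wellFormed (single-tree _) [] [] , here refl
Transl-wf (consL P formula) = let (wellFormed t l r , m) = Transl-wf P in wellFormed t (m ∷ l) r , m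
Transl-wf (consR P formula) = let (wellFormed t l r , m) = Transl-wf P in wellFormed t l (m ∷ r) , m
Transl-wf (consL {x = x} P (nested {y = y} {G = G} {G₀ = G₀} P₀ d)) with Transl-wf P | Transl-wf P₀
... | wellFormed t l r , m | wellFormed t₀ l₀ r₀ , m₀ =
  wellFormed (bridgeTree t₀ t (Disjoint-sym d) m₀ m)
             (All-++⁺ (All.map inG l) (All.map inG₀ l₀)) (All-++⁺ (All.map inG₀ r₀) (All.map inG r))
  , inG m
  where
  inG : ∀ {z} → z ∈ nodes G → z ∈ nodes (G₀ ⊕ arc y x ⊕ G)
  inG = ∈-⊕ʳ (G₀ ⊕ arc y x) G
  inG₀ : ∀ {z} → z ∈ nodes G₀ → z ∈ nodes (G₀ ⊕ arc y x ⊕ G)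
  inG₀ q = ∈-⊕ˡ (G₀ ⊕ arc y x) G (∈-⊕ˡ G₀ (arc y x) q)
Transl-wf (consR {x = x} P (nested {y = y} {G = G} {G₀ = G₀} P₀ d)) with Transl-wf P | Transl-wf P₀
... | wellFormed t l r , m | wellFormed t₀ l₀ r₀ , m₀ =
  wellFormed (bridgeTree t t₀ d m m₀)
             (All-++⁺ (All.map inG l) (All.map inG₀ l₀)) (All-++⁺ (All.map inG₀ r₀) (All.map inG r))
  , inG m
  where
  inG : ∀ {z} → z ∈ nodes G → z ∈ nodes (G ⊕ arc x y ⊕ G₀)
  inG q = ∈-⊕ˡ (G ⊕ arc x y) G₀ (∈-⊕ˡ G (arc x y) q)
  inG₀ : ∀ {z} → z ∈ nodes G₀ → z ∈ nodes (G ⊕ arc x y ⊕ G₀)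
  inG₀ = ∈-⊕ʳ (G ⊕ arc x y) G₀

root∈ : ∀ {Γ Δ x s} → Transl Γ Δ x s → x ∈ nodes (LSeq.tree s)
root∈ P = proj₂ (Transl-wf P)

-- Exchange

mutual
  ≈E-refl : ∀ e → e ≈E e
  ≈E-refl (fml A) = fml
  ≈E-refl (nest Γ Δ) = nest (≈C-refl Γ) (≈C-refl Δ)

  ≈C-refl : ∀ Γ → Γ ≈C Γ
  ≈C-refl [] = []
  ≈C-refl (e ∷ Γ) = ≈E-refl e ∷ ≈C-refl Γ

∷≈C∷ʳ : ∀ e Γ → (e ∷ Γ) ≈C (Γ ++ e ∷ [])
∷≈C∷ʳ e [] = ≈C-refl (e ∷ [])
∷≈C∷ʳ e (e' ∷ Γ) = trans swap (≈E-refl e' ∷ ∷≈C∷ʳ e Γ)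

ExtL-∼ : ∀ {e x t s t'} → ExtL e x t s → t' ∼ t → Σ LSeq λ s' → ExtL e x t' s' × (s' ∼ s)
ExtL-∼ {t' = _ ⊢[ _ ] _} formula (a , b , c) = _ , formula , (prep _ a , b , c)
ExtL-∼ {t' = _ ⊢[ _ ] _} (nested P₀ d) (a , b , c) =
  _ , nested P₀ (Disjoint-≅ (≅-sym b) d) , (↭.++⁺ʳ _ a , ⊕-cong ≅-refl b , ↭.++⁺ˡ _ c)

ExtR-∼ : ∀ {e x t s t'} → ExtR e x t s → t' ∼ t → Σ LSeq λ s' → ExtR e x t' s' × (s' ∼ s)
ExtR-∼ {t' = _ ⊢[ _ ] _} formula (a , b , c) = _ , formula , (a , b , prep _ c)
ExtR-∼ {t' = _ ⊢[ _ ] _} (nested P₀ d) (a , b , c) =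
  _ , nested P₀ (Disjoint-≅ (≅-sym b) d) , (↭.++⁺ʳ _ a , ⊕-cong (⊕-cong b ≅-refl) ≅-refl , ↭.++⁺ˡ _ c)

commLR : ∀ {e d x t₀ t₁ s} → ExtL e x t₀ t₁ → ExtR d x t₁ s → x ∈ nodes (LSeq.tree t₀)
       → Σ LSeq λ u₀ → Σ LSeq λ u₁ → ExtR d x t₀ u₀ × ExtL e x u₀ u₁ × (u₁ ∼ s)
commLR formula formula m = _ , _ , formula , formula , ∼-refl
commLR formula (nested P₁ d₁) m = _ , _ , nested P₁ d₁ , formula , ∼-refl
commLR {x = x} (nested {Π = Π} {Π₀ = Π₀} P₀ d₀) (formula {A = B}) m =
  _ , _ , formula , nested P₀ d₀ , (↭-refl , ≅-refl , Perm.x∙yz≈y∙xz Π₀ ((x , B) ∷ []) Π)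
commLR {x = x} (nested {y = y} {Λ = Λ} {G = G} {Π = Π} {Λ₀ = Λ₀} {G₀ = G₀} {Π₀ = Π₀} P₀ d₀)
               (nested {y = z} {Λ₀ = Λ₁} {G₀ = G₁} {Π₀ = Π₁} P₁ d₁) m =
  _ , _ , nested P₁ (Disjoint-⊕⁻ʳ d₁) , nested P₀ d ,
  ( Perm.xy∙z≈xz∙y Λ Λ₁ Λ₀
  , solve 5 (λ g₀ a₁ g a₂ g₁ → (g₀ ⊛ a₁) ⊛ ((g ⊛ a₂) ⊛ g₁) ⊜ (((g₀ ⊛ a₁) ⊛ g) ⊛ a₂) ⊛ g₁)
            ≅-refl G₀ (arc y x) G (arc x z) G₁
  , Perm.x∙yz≈y∙xz Π₀ Π₁ Π )
  where
  d : Disjoint (G ⊕ arc x z ⊕ G₁) G₀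
  d = Disjoint-⊕ (Disjoint-⊕ d₀ (Disjoint-arc (Disjoint-∉ˡ d₀ m)
                   (λ q → Disjoint-∉ʳ d₁ (root∈ P₁) (∈-⊕ˡ (G₀ ⊕ arc y x) G (∈-⊕ˡ G₀ (arc y x) q)))))
                 (Disjoint-sym (Disjoint-⊕⁻ˡ (Disjoint-⊕⁻ˡ d₁)))

commRL : ∀ {e d x t₀ t₁ s} → ExtR d x t₀ t₁ → ExtL e x t₁ s → x ∈ nodes (LSeq.tree t₀)
       → Σ LSeq λ u₀ → Σ LSeq λ u₁ → ExtL e x t₀ u₀ × ExtR d x u₀ u₁ × (u₁ ∼ s)
commRL formula formula m = _ , _ , formula , formula , ∼-refl
commRL {x = x} (formula {A = B} {Π = Π}) (nested {Π₀ = Π₀} P₀ d₀) m =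
  _ , _ , nested P₀ d₀ , formula , (↭-refl , ≅-refl , Perm.x∙yz≈y∙xz ((x , B) ∷ []) Π₀ Π)
commRL (nested P₁ d₁) formula m = _ , _ , formula , nested P₁ d₁ , ∼-refl
commRL {x = x} (nested {y = z} {Λ = Λ} {G = G} {Π = Π} {Λ₀ = Λ₁} {G₀ = G₁} {Π₀ = Π₁} P₁ d₁)
               (nested {y = y} {Λ₀ = Λ₀} {G₀ = G₀} {Π₀ = Π₀} P₀ d₀) m =
  _ , _ , nested P₀ (Disjoint-⊕⁻ˡ (Disjoint-⊕⁻ˡ d₀)) , nested P₁ d ,
  ( Perm.xy∙z≈xz∙y Λ Λ₀ Λ₁
  , solve 5 (λ g₀ a₁ g a₂ g₁ → (((g₀ ⊛ a₁) ⊛ g) ⊛ a₂) ⊛ g₁ ⊜ (g₀ ⊛ a₁) ⊛ ((g ⊛ a₂) ⊛ g₁))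
            ≅-refl G₀ (arc y x) G (arc x z) G₁
  , Perm.x∙yz≈y∙xz Π₁ Π₀ Π )
  where
  d : Disjoint (G₀ ⊕ arc y x ⊕ G) G₁
  d = Disjoint-⊕ (Disjoint-⊕ (Disjoint-sym (Disjoint-⊕⁻ʳ d₀))
                   (Disjoint-arc (λ q → Disjoint-∉ʳ d₀ (root∈ P₀) (∈-⊕ʳ (G ⊕ arc x z) G₁ q)) (Disjoint-∉ˡ d₁ m)))
                 d₁

commLL : ∀ {e e' x t₀ t₁ s} → ExtL e x t₀ t₁ → ExtL e' x t₁ s → x ∈ nodes (LSeq.tree t₀)
       → Σ LSeq λ u₀ → Σ LSeq λ u₁ → ExtL e' x t₀ u₀ × ExtL e x u₀ u₁ × (u₁ ∼ s)
commLL formula formula m = _ , _ , formula , formula , (↭-swap _ _ ↭-refl , ≅-refl , ↭-refl)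
commLL formula (nested P₁ d₁) m = _ , _ , nested P₁ d₁ , formula , ∼-refl
commLL (nested P₀ d₀) formula m = _ , _ , formula , nested P₀ d₀ , ∼-refl
commLL {x = x} (nested {y = y} {Λ = Λ} {G = G} {Π = Π} {Λ₀ = Λ₀} {G₀ = G₀} {Π₀ = Π₀} P₀ d₀)
               (nested {y = z} {Λ₀ = Λ₁} {G₀ = G₁} {Π₀ = Π₁} P₁ d₁) m =
  _ , _ , nested P₁ (Disjoint-⊕⁻ʳ d₁) , nested P₀ d ,
  ( Perm.xy∙z≈xz∙y Λ Λ₁ Λ₀
  , solve 5 (λ g₀ a₁ g a₂ g₁ → (g₀ ⊛ a₁) ⊛ ((g₁ ⊛ a₂) ⊛ g) ⊜ (g₁ ⊛ a₂) ⊛ ((g₀ ⊛ a₁) ⊛ g))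
            ≅-refl G₀ (arc y x) G (arc z x) G₁
  , Perm.x∙yz≈y∙xz Π₀ Π₁ Π )
  where
  d : Disjoint (G₁ ⊕ arc z x ⊕ G) G₀
  d = Disjoint-⊕ (Disjoint-⊕ (Disjoint-sym (Disjoint-⊕⁻ˡ (Disjoint-⊕⁻ˡ d₁)))
                   (Disjoint-arc (λ q → Disjoint-∉ʳ d₁ (root∈ P₁) (∈-⊕ˡ (G₀ ⊕ arc y x) G (∈-⊕ˡ G₀ (arc y x) q)))
                                 (Disjoint-∉ˡ d₀ m)))
                 d₀

commRR : ∀ {d d' x t₀ t₁ s} → ExtR d x t₀ t₁ → ExtR d' x t₁ s → x ∈ nodes (LSeq.tree t₀)
       → Σ LSeq λ u₀ → Σ LSeq λ u₁ → ExtR d' x t₀ u₀ × ExtR d x u₀ u₁ × (u₁ ∼ s)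
commRR formula formula m = _ , _ , formula , formula , (↭-refl , ≅-refl , ↭-swap _ _ ↭-refl)
commRR {x = x} (formula {A = A} {Π = Π}) (nested {Π₀ = Π₁} P₁ d₁) m =
  _ , _ , nested P₁ d₁ , formula , (↭-refl , ≅-refl , Perm.x∙yz≈y∙xz ((x , A) ∷ []) Π₁ Π)
commRR {x = x} (nested {Π = Π} {Π₀ = Π₀} P₀ d₀) (formula {A = B}) m =
  _ , _ , formula , nested P₀ d₀ , (↭-refl , ≅-refl , Perm.x∙yz≈y∙xz Π₀ ((x , B) ∷ []) Π)
commRR {x = x} (nested {y = y} {Λ = Λ} {G = G} {Π = Π} {Λ₀ = Λ₀} {G₀ = G₀} {Π₀ = Π₀} P₀ d₀)
               (nested {y = z} {Λ₀ = Λ₁} {G₀ = G₁} {Π₀ = Π₁} P₁ d₁) m =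
  _ , _ , nested P₁ (Disjoint-⊕⁻ˡ (Disjoint-⊕⁻ˡ d₁)) , nested P₀ d ,
  ( Perm.xy∙z≈xz∙y Λ Λ₁ Λ₀
  , solve 5 (λ g₀ a₁ g a₂ g₁ → (((g ⊛ a₂) ⊛ g₁) ⊛ a₁) ⊛ g₀ ⊜ (((g ⊛ a₁) ⊛ g₀) ⊛ a₂) ⊛ g₁)
            ≅-refl G₀ (arc x y) G (arc x z) G₁
  , Perm.x∙yz≈y∙xz Π₀ Π₁ Π )
  where
  d : Disjoint (G ⊕ arc x z ⊕ G₁) G₀
  d = Disjoint-⊕ (Disjoint-⊕ d₀ (Disjoint-arc (Disjoint-∉ˡ d₀ m)
                   (λ q → Disjoint-∉ʳ d₁ (root∈ P₁) (∈-⊕ʳ (G ⊕ arc x y) G₀ q))))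
                 (Disjoint-sym (Disjoint-⊕⁻ʳ d₁))

invL : ∀ {e Γ Δ x s} → Transl (e ∷ Γ) Δ x s
     → Σ LSeq λ s₀ → Σ LSeq λ s₁ → Transl Γ Δ x s₀ × ExtL e x s₀ s₁ × (s₁ ∼ s)
invL (consL P E) = _ , _ , P , E , ∼-refl
invL (consR P E') =
  let (t₀ , t₁ , P' , E , sim) = invL P
      (s' , E'' , sim') = ExtR-∼ E' sim
      (u₀ , u₁ , R , L , sim'') = commLR E E'' (root∈ P')
  in u₀ , u₁ , consR P' R , L , ∼-trans sim'' sim'

invR : ∀ {d Γ Δ x s} → Transl Γ (d ∷ Δ) x s
     → Σ LSeq λ s₀ → Σ LSeq λ s₁ → Transl Γ Δ x s₀ × ExtR d x s₀ s₁ × (s₁ ∼ s)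
invR (consR P E) = _ , _ , P , E , ∼-refl
invR (consL P E') =
  let (t₀ , t₁ , P' , E , sim) = invR P
      (s' , E'' , sim') = ExtL-∼ E' sim
      (u₀ , u₁ , L , R , sim'') = commRL E E'' (root∈ P')
  in u₀ , u₁ , consL P' L , R , ∼-trans sim'' sim'

mutual
  ExtL-≈E : ∀ {e e' x t t'} → e ≈E e' → ExtL e' x t t' → Σ LSeq λ t'' → ExtL e x t t'' × (t'' ∼ t')
  ExtL-≈E fml formula = _ , formula , ∼-refl
  ExtL-≈E (nest p q) (nested P₀ d) with Transl-≈C p q P₀
  ... | (_ ⊢[ _ ] _) , P₀' , (a , b , c) =
    _ , nested P₀' (Disjoint-sym (Disjoint-≅ (≅-sym b) (Disjoint-sym d))) , (↭.++⁺ˡ _ a , ⊕-cong (⊕-cong b ≅-refl) ≅-refl , ↭.++⁺ʳ _ c)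

  ExtR-≈E : ∀ {e e' x t t'} → e ≈E e' → ExtR e' x t t' → Σ LSeq λ t'' → ExtR e x t t'' × (t'' ∼ t')
  ExtR-≈E fml formula = _ , formula , ∼-refl
  ExtR-≈E (nest p q) (nested P₀ d) with Transl-≈C p q P₀
  ... | (_ ⊢[ _ ] _) , P₀' , (a , b , c) =
    _ , nested P₀' (Disjoint-sym (Disjoint-≅ (≅-sym b) (Disjoint-sym d))) , (↭.++⁺ˡ _ a , ⊕-cong ≅-refl b , ↭.++⁺ʳ _ c)

  Transl-≈Cˡ : ∀ {Γ Γ' Δ x s} → Γ ≈C Γ' → Transl Γ' Δ x s → Σ LSeq λ s' → Transl Γ Δ x s' × (s' ∼ s)
  Transl-≈Cˡ [] P = _ , P , ∼-refl
  Transl-≈Cˡ (e≈ ∷ r) P =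
    let (t₀ , t₁ , P' , E , sim) = invL P
        (t₀' , P'' , sim₀) = Transl-≈Cˡ r P'
        (t₁' , E' , sim₁) = ExtL-∼ E sim₀
        (t₁'' , E'' , sim₂) = ExtL-≈E e≈ E'
    in t₁'' , consL P'' E'' , ∼-trans sim₂ (∼-trans sim₁ sim)
  Transl-≈Cˡ swap P =
    let (t₀ , t₁ , P₀ , E' , sim) = invL P
        (u₀ , u₁ , P₁ , E , sim₀) = invL P₀
        (t₁' , E'' , sim₁) = ExtL-∼ E' sim₀
        (v₀ , v₁ , F' , F , sim₂) = commLL E E'' (root∈ P₁)
    in v₁ , consL (consL P₁ F') F , ∼-trans sim₂ (∼-trans sim₁ sim)
  Transl-≈Cˡ (trans p q) P =
    let (s₁ , P₁ , sim₁) = Transl-≈Cˡ q P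
        (s₂ , P₂ , sim₂) = Transl-≈Cˡ p P₁
    in s₂ , P₂ , ∼-trans sim₂ sim₁

  Transl-≈Cʳ : ∀ {Γ Δ Δ' x s} → Δ ≈C Δ' → Transl Γ Δ' x s → Σ LSeq λ s' → Transl Γ Δ x s' × (s' ∼ s)
  Transl-≈Cʳ [] P = _ , P , ∼-refl
  Transl-≈Cʳ (e≈ ∷ r) P =
    let (t₀ , t₁ , P' , E , sim) = invR P
        (t₀' , P'' , sim₀) = Transl-≈Cʳ r P'
        (t₁' , E' , sim₁) = ExtR-∼ E sim₀
        (t₁'' , E'' , sim₂) = ExtR-≈E e≈ E'
    in t₁'' , consR P'' E'' , ∼-trans sim₂ (∼-trans sim₁ sim)
  Transl-≈Cʳ swap P =
    let (t₀ , t₁ , P₀ , E' , sim) = invR P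
        (u₀ , u₁ , P₁ , E , sim₀) = invR P₀
        (t₁' , E'' , sim₁) = ExtR-∼ E' sim₀
        (v₀ , v₁ , F' , F , sim₂) = commRR E E'' (root∈ P₁)
    in v₁ , consR (consR P₁ F') F , ∼-trans sim₂ (∼-trans sim₁ sim)
  Transl-≈Cʳ (trans p q) P =
    let (s₁ , P₁ , sim₁) = Transl-≈Cʳ q P
        (s₂ , P₂ , sim₂) = Transl-≈Cʳ p P₁
    in s₂ , P₂ , ∼-trans sim₂ sim₁

  Transl-≈C : ∀ {Γ Γ' Δ Δ' x s} → Γ ≈C Γ' → Δ ≈C Δ' → Transl Γ' Δ' x s → Σ LSeq λ s' → Transl Γ Δ x s' × (s' ∼ s)
  Transl-≈C p q P =
    let (s₁ , P₁ , sim₁) = Transl-≈Cʳ q P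
        (s₂ , P₂ , sim₂) = Transl-≈Cˡ p P₁
    in s₂ , P₂ , ∼-trans sim₂ sim₁

-- Splitting at the root

infixl 5 _⊞_
_⊞_ : LSeq → LSeq → LSeq
(Λ ⊢[ G ] Π) ⊞ (Λ' ⊢[ G' ] Π') = Λ ++ Λ' ⊢[ G ⊕ G' ] Π ++ Π'

⊞-comm : ∀ s u → (s ⊞ u) ∼ (u ⊞ s)
⊞-comm (Λ ⊢[ G ] Π) (Λ' ⊢[ G' ] Π') = ↭.++-comm Λ Λ' , ⊕-comm G G' , ↭.++-comm Π Π'

⊞-cong : ∀ {s s' u u'} → s ∼ s' → u ∼ u' → (s ⊞ u) ∼ (s' ⊞ u')
⊞-cong (a , b , c) (a' , b' , c') = ↭.++⁺ a a' , ⊕-cong b b' , ↭.++⁺ c c'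

⊞-rotate : ∀ a e c → ((a ⊞ e) ⊞ c) ∼ (a ⊞ (c ⊞ e))
⊞-rotate (Λa ⊢[ Ga ] Πa) (Λe ⊢[ Ge ] Πe) (Λc ⊢[ Gc ] Πc) =
  ( Perm.xy∙z≈x∙zy Λa Λe Λc
  , solve 3 (λ a e c → (a ⊛ e) ⊛ c ⊜ a ⊛ (c ⊛ e)) ≅-refl Ga Ge Gc
  , Perm.xy∙z≈x∙zy Πa Πe Πc )

record Meet (x : Label) (G H : Graph) : Set where
  constructor meetAt
  field meet : ∀ z → z ∈ nodes G → z ∈ nodes H → z ≡ x
open Meet public

Meet-sym : ∀ {x G H} → Meet x G H → Meet x H G
Meet-sym m = meetAt λ z p q → meet m z q p

Meet-⊆ : ∀ {x G G' H} → (∀ {z} → z ∈ nodes G' → z ∈ nodes G) → Meet x G H → Meet x G' H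
Meet-⊆ f m = meetAt λ z p q → meet m z (f p) q

Meet-⊕ : ∀ {x G G' H} → Meet x G H → Meet x G' H → Meet x (G ⊕ G') H
Meet-⊕ {G = G} m m' = meetAt λ z p q → [ (λ r → meet m z r q) , (λ r → meet m' z r q) ]′ (∈-++⁻ (nodes G) p)

Meet-disjoint : ∀ {x G H} → Disjoint G H → Meet x G H
Meet-disjoint d = meetAt λ z p q → ⊥-elim (disjoint-∉ d z p q)

Meet-arcTo : ∀ {x z H} → z ∉ nodes H → Meet x (arc z x) H
Meet-arcTo z∉ = meetAt λ { w (here refl) q → ⊥-elim (z∉ q) ; w (there (here e)) q → e }

Meet-arcFrom : ∀ {x z H} → z ∉ nodes H → Meet x (arc x z) H
Meet-arcFrom z∉ = meetAt λ { w (here e) q → e ; w (there (here refl)) q → ⊥-elim (z∉ q) }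

ExtL-⊆ : ∀ {e x t s} → ExtL e x t s → ∀ {z} → z ∈ nodes (LSeq.tree t) → z ∈ nodes (LSeq.tree s)
ExtL-⊆ formula p = p
ExtL-⊆ (nested {x = x} {y = y} {G = G} {G₀ = G₀} P₀ d) p = ∈-⊕ʳ (G₀ ⊕ arc y x) G p

ExtR-⊆ : ∀ {e x t s} → ExtR e x t s → ∀ {z} → z ∈ nodes (LSeq.tree t) → z ∈ nodes (LSeq.tree s)
ExtR-⊆ formula p = p
ExtR-⊆ (nested {x = x} {y = y} {G = G} {G₀ = G₀} P₀ d) p = ∈-⊕ˡ (G ⊕ arc x y) G₀ (∈-⊕ˡ G (arc x y) p)

ExtL-⊞ : ∀ {e x t s} (u : LSeq) → ExtL e x t s → Meet x (LSeq.tree s) (LSeq.tree u) → x ∈ nodes (LSeq.tree t)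
       → Σ LSeq λ w → ExtL e x (t ⊞ u) w × (w ∼ s ⊞ u)
ExtL-⊞ (Λu ⊢[ Gu ] Πu) formula m x∈ = _ , formula , ∼-refl
ExtL-⊞ {x = x} (Λu ⊢[ Gu ] Πu) (nested {y = y} {Λ = Λ} {G = G} {Π = Π} {Λ₀ = Λ₀} {G₀ = G₀} {Π₀ = Π₀} P₀ d) m x∈ =
  _ , nested P₀ (Disjoint-⊕ d d') ,
  ( Perm.xy∙z≈xz∙y Λ Λu Λ₀
  , solve 4 (λ g₀ a g gu → (g₀ ⊛ a) ⊛ (g ⊛ gu) ⊜ ((g₀ ⊛ a) ⊛ g) ⊛ gu) ≅-refl G₀ (arc y x) G Gu
  , ↭-reflexive (sym (++-assoc Π₀ Π Πu)) )
  where
  d' : Disjoint Gu G₀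
  d' = disjoint λ z p q → disjoint-∉ d x x∈ (subst (_∈ nodes G₀)
                            (meet m z (∈-⊕ˡ (G₀ ⊕ arc y x) G (∈-⊕ˡ G₀ (arc y x) q)) p) q)

ExtR-⊞ : ∀ {e x t s} (u : LSeq) → ExtR e x t s → Meet x (LSeq.tree s) (LSeq.tree u) → x ∈ nodes (LSeq.tree t)
       → Σ LSeq λ w → ExtR e x (t ⊞ u) w × (w ∼ s ⊞ u)
ExtR-⊞ (Λu ⊢[ Gu ] Πu) formula m x∈ = _ , formula , ∼-refl
ExtR-⊞ {x = x} (Λu ⊢[ Gu ] Πu) (nested {y = y} {Λ = Λ} {G = G} {Π = Π} {Λ₀ = Λ₀} {G₀ = G₀} {Π₀ = Π₀} P₀ d) m x∈ =
  _ , nested P₀ (Disjoint-⊕ d d') ,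
  ( Perm.xy∙z≈xz∙y Λ Λu Λ₀
  , solve 4 (λ g₀ a g gu → ((g ⊛ gu) ⊛ a) ⊛ g₀ ⊜ ((g ⊛ a) ⊛ g₀) ⊛ gu) ≅-refl G₀ (arc x y) G Gu
  , ↭-reflexive (sym (++-assoc Π₀ Π Πu)) )
  where
  d' : Disjoint Gu G₀
  d' = disjoint λ z p q → disjoint-∉ d x x∈ (subst (_∈ nodes G₀) (meet m z (∈-⊕ʳ (G ⊕ arc x y) G₀ q) p) q)

ExtL-⊞⁻ : ∀ {e x t u s} → ExtL e x (t ⊞ u) s → Meet x (LSeq.tree t) (LSeq.tree u)
        → Σ LSeq λ t' → ExtL e x t t' × ((t' ⊞ u) ∼ s) × Meet x (LSeq.tree t') (LSeq.tree u)
ExtL-⊞⁻ {t = _ ⊢[ _ ] _} {u = _ ⊢[ _ ] _} formula m = _ , formula , ∼-refl , m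
ExtL-⊞⁻ {x = x} {t = Λ ⊢[ G ] Π} {u = Λu ⊢[ Gu ] Πu} (nested {y = y} {Λ₀ = Λ₀} {G₀ = G₀} {Π₀ = Π₀} P₀ d) m =
  _ , nested P₀ (Disjoint-⊕⁻ˡ d) ,
  ( Perm.xy∙z≈xz∙y Λ Λ₀ Λu
  , solve 4 (λ g₀ a g gu → ((g₀ ⊛ a) ⊛ g) ⊛ gu ⊜ (g₀ ⊛ a) ⊛ (g ⊛ gu)) ≅-refl G₀ (arc y x) G Gu
  , ↭-reflexive (++-assoc Π₀ Π Πu) )
  , meetAt meet'
  where
  meet' : ∀ z → z ∈ nodes (G₀ ⊕ arc y x ⊕ G) → z ∈ nodes Gu → z ≡ x
  meet' z p q with ∈-++⁻ (nodes (G₀ ⊕ arc y x)) p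
  ... | inj₂ r = meet m z r q
  ... | inj₁ r with ∈-++⁻ (nodes G₀) r
  ...   | inj₁ r₀ = ⊥-elim (disjoint-∉ d z (∈-⊕ʳ G Gu q) r₀)
  ...   | inj₂ (here refl) = ⊥-elim (disjoint-∉ d z (∈-⊕ʳ G Gu q) (root∈ P₀))
  ...   | inj₂ (there (here refl)) = refl

ExtR-⊞⁻ : ∀ {e x t u s} → ExtR e x (t ⊞ u) s → Meet x (LSeq.tree t) (LSeq.tree u)
        → Σ LSeq λ t' → ExtR e x t t' × ((t' ⊞ u) ∼ s) × Meet x (LSeq.tree t') (LSeq.tree u)
ExtR-⊞⁻ {t = _ ⊢[ _ ] _} {u = _ ⊢[ _ ] _} formula m = _ , formula , ∼-refl , m
ExtR-⊞⁻ {x = x} {t = Λ ⊢[ G ] Π} {u = Λu ⊢[ Gu ] Πu} (nested {y = y} {Λ₀ = Λ₀} {G₀ = G₀} {Π₀ = Π₀} P₀ d) m =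
  _ , nested P₀ (Disjoint-⊕⁻ˡ d) ,
  ( Perm.xy∙z≈xz∙y Λ Λ₀ Λu
  , solve 4 (λ g₀ a g gu → ((g ⊛ a) ⊛ g₀) ⊛ gu ⊜ ((g ⊛ gu) ⊛ a) ⊛ g₀) ≅-refl G₀ (arc x y) G Gu
  , ↭-reflexive (++-assoc Π₀ Π Πu) )
  , meetAt meet'
  where
  meet' : ∀ z → z ∈ nodes (G ⊕ arc x y ⊕ G₀) → z ∈ nodes Gu → z ≡ x
  meet' z p q with ∈-++⁻ (nodes (G ⊕ arc x y)) p
  ... | inj₂ r₀ = ⊥-elim (disjoint-∉ d z (∈-⊕ʳ G Gu q) r₀)
  ... | inj₁ r with ∈-++⁻ (nodes G) r
  ...   | inj₁ r₁ = meet m z r₁ q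
  ...   | inj₂ (here refl) = refl
  ...   | inj₂ (there (here refl)) = ⊥-elim (disjoint-∉ d z (∈-⊕ʳ G Gu q) (root∈ P₀))

append : ∀ {Γa Δa Γb Δb x sa sb} → Transl Γa Δa x sa → Transl Γb Δb x sb → Meet x (LSeq.tree sa) (LSeq.tree sb)
       → Σ LSeq λ s → Transl (Γa ++ Γb) (Δa ++ Δb) x s × (s ∼ sa ⊞ sb)
append empty Pb m = _ , Pb , (↭-refl , ≅-sym (single-absorbˡ (root∈ Pb)) , ↭-refl)
append {sb = sb} (consL Pa E) Pb m =
  let (s' , P' , sim) = append Pa Pb (Meet-⊆ (ExtL-⊆ E) m)
      (w , E' , simw) = ExtL-⊞ sb E m (root∈ Pa)
      (w' , E'' , simw') = ExtL-∼ E' sim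
  in w' , consL P' E'' , ∼-trans simw' simw
append {sb = sb} (consR Pa E) Pb m =
  let (s' , P' , sim) = append Pa Pb (Meet-⊆ (ExtR-⊆ E) m)
      (w , E' , simw) = ExtR-⊞ sb E m (root∈ Pa)
      (w' , E'' , simw') = ExtR-∼ E' sim
  in w' , consR P' E'' , ∼-trans simw' simw

Split : Ctx → Ctx → Ctx → Ctx → Label → LSeq → Set
Split Γa Γb Δa Δb x s = Σ LSeq λ sa → Σ LSeq λ sb → Transl Γa Δa x sa × Transl Γb Δb x sb
                        × Meet x (LSeq.tree sa) (LSeq.tree sb) × ((sa ⊞ sb) ∼ s)

split : ∀ Γa Γb Δa Δb {Γ Δ x s} → Transl Γ Δ x s → Γ ≡ Γa ++ Γb → Δ ≡ Δa ++ Δb → Split Γa Γb Δa Δb x s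
split [] [] [] [] empty refl refl =
  _ , _ , empty , empty , meetAt (λ { z (here refl) _ → refl ; z (there ()) _ }) , (↭-refl , single-absorbʳ (here refl) , ↭-refl)
split [] [] [] (_ ∷ _) empty refl ()
split [] [] (_ ∷ _) _ empty refl ()
split [] (_ ∷ _) _ _ empty () _
split (_ ∷ _) _ _ _ empty () _
split [] [] Δa Δb (consL P E) () _
split (e ∷ Γa) Γb Δa Δb (consL P E) refl eqΔ =
  let (ta , sb , Pa , Pb , m , sim) = split Γa Γb Δa Δb P refl eqΔ
      (s' , E₁ , sim₁) = ExtL-∼ E sim
      (ta' , E₂ , sim₂ , m') = ExtL-⊞⁻ E₁ m
  in ta' , sb , consL Pa E₂ , Pb , m' , ∼-trans sim₂ sim₁
split [] (e ∷ Γb) Δa Δb (consL P E) refl eqΔ =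
  let (sa , tb , Pa , Pb , m , sim) = split [] Γb Δa Δb P refl eqΔ
      (s' , E₁ , sim₁) = ExtL-∼ E (∼-trans (⊞-comm tb sa) sim)
      (tb' , E₂ , sim₂ , m') = ExtL-⊞⁻ E₁ (Meet-sym m)
  in sa , tb' , Pa , consL Pb E₂ , Meet-sym m' , ∼-trans (⊞-comm sa tb') (∼-trans sim₂ sim₁)
split Γa Γb (d ∷ Δa) Δb (consR P E) eqΓ refl =
  let (ta , sb , Pa , Pb , m , sim) = split Γa Γb Δa Δb P eqΓ refl
      (s' , E₁ , sim₁) = ExtR-∼ E sim
      (ta' , E₂ , sim₂ , m') = ExtR-⊞⁻ E₁ m
  in ta' , sb , consR Pa E₂ , Pb , m' , ∼-trans sim₂ sim₁
split Γa Γb [] (d ∷ Δb) (consR P E) eqΓ refl =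
  let (sa , tb , Pa , Pb , m , sim) = split Γa Γb [] Δb P eqΓ refl
      (s' , E₁ , sim₁) = ExtR-∼ E (∼-trans (⊞-comm tb sa) sim)
      (tb' , E₂ , sim₂ , m') = ExtR-⊞⁻ E₁ (Meet-sym m)
  in sa , tb' , Pa , consR Pb E₂ , Meet-sym m' , ∼-trans (⊞-comm sa tb') (∼-trans sim₂ sim₁)

splitSides : ∀ {Γ Δ x s} → Transl Γ Δ x s → Split Γ [] [] Δ x s
splitSides {Γ} {Δ} P = split Γ [] [] Δ P (sym (++-identityʳ Γ)) refl

splitNested : ∀ Γ Γ₀ Δ₀ Δ {x s} → Transl (Γ ++ Γ₀) (Δ₀ ++ Δ) x s → Split Γ Γ₀ Δ Δ₀ x s
splitNested Γ Γ₀ Δ₀ Δ {x} P =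
  let (a , b , PΓ , P' , m₁ , sim₁) = split Γ Γ₀ [] (Δ₀ ++ Δ) P refl refl
      (c , e , P₀ , PΔ , m₂ , sim₂) = split Γ₀ [] Δ₀ Δ P' (sym (++-identityʳ Γ₀)) refl
      e⊆b : ∀ {z} → z ∈ nodes (LSeq.tree e) → z ∈ nodes (LSeq.tree b)
      e⊆b q = ≅⇒⊆ (proj₁ (proj₂ sim₂)) (∈-⊕ʳ (LSeq.tree c) (LSeq.tree e) q)
      c⊆b : ∀ {z} → z ∈ nodes (LSeq.tree c) → z ∈ nodes (LSeq.tree b)
      c⊆b q = ≅⇒⊆ (proj₁ (proj₂ sim₂)) (∈-⊕ˡ (LSeq.tree c) (LSeq.tree e) q)
      (g , Pg , simg) = append PΓ PΔ (Meet-sym (Meet-⊆ e⊆b (Meet-sym m₁)))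
      mg : Meet x (LSeq.tree g) (LSeq.tree c)
      mg = meetAt λ z p q → [ (λ r → meet m₁ z r (c⊆b q)) , (λ r → meet m₂ z q r) ]′
                              (∈-++⁻ (nodes (LSeq.tree a)) (≅⇒⊆ (proj₁ (proj₂ simg)) p))
  in g , c , subst (λ Γ' → Transl Γ' Δ x g) (++-identityʳ Γ) Pg , P₀ , mg
     , ∼-trans (⊞-cong simg ∼-refl)
               (∼-trans (⊞-rotate a e c) (∼-trans (⊞-cong ∼-refl sim₂) sim₁))

-- Renaming

ren-hit : ∀ y x → ren y x x ≡ y
ren-hit y x with x ≡ᵇ x in eq
... | true = refl
... | false = ⊥-elim (subst T eq (≡⇒≡ᵇ x x refl))

ren-miss : ∀ y x z → z ≢ x → ren y x z ≡ z
ren-miss y x z z≢x with z ≡ᵇ x in eq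
... | true = ⊥-elim (z≢x (≡ᵇ⇒≡ z x (subst T (sym eq) tt)))
... | false = refl

ren-inv : ∀ x y z → z ≢ y → ren x y (ren y x z) ≡ z
ren-inv x y z z≢y with z ≟ x
... | yes refl = ≡-trans (cong (ren x y) (ren-hit y z)) (ren-hit z y)
... | no z≢x = ≡-trans (cong (ren x y) (ren-miss y x z z≢x)) (ren-miss x y z z≢y)

∈⇒≢ : ∀ {A : Set} {x z : A} {xs} → x ∉ xs → z ∈ xs → z ≢ x
∈⇒≢ x∉ z∈ refl = x∉ z∈

renG-∈ : ∀ {y x z} G → z ∈ nodes G → ren y x z ∈ nodes (renG y x G)
renG-∈ {y} {x} G = ∈-map⁺ (ren y x)

renG-∈⁻ : ∀ {y x z} G → z ∈ nodes (renG y x G) → z ≡ y ⊎ (z ∈ nodes G × z ≢ x)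
renG-∈⁻ {y} {x} G p with ∈-map⁻ (ren y x) p
... | w , q , refl with w ≟ x
...   | yes refl = inj₁ (ren-hit y x)
...   | no w≢x rewrite ren-miss y x w w≢x = inj₂ (q , w≢x)

renG-⊕ : ∀ y x G H → renG y x (G ⊕ H) ≡ renG y x G ⊕ renG y x H
renG-⊕ y x G H = cong₂ graph (map-++ _ (nodes G) (nodes H)) (map-++ _ (arcs G) (arcs H))

renG-id : ∀ y x {G} → x ∉ nodes G → ArcsIn G → renG y x G ≡ G
renG-id y x x∉ an = cong₂ graph
  (map-id-local (All.tabulate λ q → ren-miss y x _ (∈⇒≢ x∉ q)))
  (map-id-local (All.tabulate λ q → cong₂ _,_ (ren-miss y x _ (∈⇒≢ x∉ (proj₁ (an q))))
                                              (ren-miss y x _ (∈⇒≢ x∉ (proj₂ (an q))))))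

renG-inv : ∀ x y {G} → y ∉ nodes G → ArcsIn G → renG x y (renG y x G) ≡ G
renG-inv x y {graph ns as} y∉ an = cong₂ graph
  (≡-trans (sym (map-∘ ns)) (map-id-local (All.tabulate λ q → ren-inv x y _ (∈⇒≢ y∉ q))))
  (≡-trans (sym (map-∘ as)) (map-id-local (All.tabulate λ q → cong₂ _,_ (ren-inv x y _ (∈⇒≢ y∉ (proj₁ (an q))))
                                                                        (ren-inv x y _ (∈⇒≢ y∉ (proj₂ (an q)))))))

Avoids : Label → LCtx → Set
Avoids x L = All (λ p → proj₁ p ≢ x) L

LabelsIn⇒Avoids : ∀ {L G x} → LabelsIn L G → x ∉ nodes G → Avoids x L
LabelsIn⇒Avoids l x∉ = All.map (∈⇒≢ x∉) l

renC-id : ∀ y x {L} → Avoids x L → renC y x L ≡ L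
renC-id y x av = map-id-local (All.map (λ {p} z≢x → cong (_, proj₂ p) (ren-miss y x (proj₁ p) z≢x)) av)

renC-inv : ∀ x y L → Avoids y L → renC x y (renC y x L) ≡ L
renC-inv x y L av = ≡-trans (sym (map-∘ L)) (map-id-local (All.map (λ {p} z≢y → cong (_, proj₂ p) (ren-inv x y (proj₁ p) z≢y)) av))

LabelsIn-renC : ∀ {y x L G} → LabelsIn L G → LabelsIn (renC y x L) (renG y x G)
LabelsIn-renC {G = G} l = map⁺ (All.map (renG-∈ G) l)

Disjoint-renG : ∀ {y x G H} → Disjoint G H → y ∉ nodes H → Disjoint (renG y x G) H
Disjoint-renG {G = G} d y∉ = disjoint λ z p q → [ (λ { refl → y∉ q }) , (λ r → disjoint-∉ d z (proj₁ r) q) ]′ (renG-∈⁻ G p)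

⊢-cong : ∀ {Λ Λ' G G' Π Π'} → Λ ≡ Λ' → G ≡ G' → Π ≡ Π' → (Λ ⊢[ G ] Π) ≡ (Λ' ⊢[ G' ] Π')
⊢-cong refl refl refl = refl

renS : Label → Label → LSeq → LSeq
renS y x (Λ ⊢[ G ] Π) = renC y x Λ ⊢[ renG y x G ] renC y x Π

renC-++ : ∀ y x L M → renC y x (L ++ M) ≡ renC y x L ++ renC y x M
renC-++ y x L M = map-++ _ L M

ren-fresh : ∀ {Γ Δ y x z Λ G Π} → Transl Γ Δ z (Λ ⊢[ G ] Π) → x ∉ nodes G
          → renC y x Λ ≡ Λ × renG y x G ≡ G × renC y x Π ≡ Π × ren y x z ≡ z
ren-fresh {y = y} {x} {G = G} P x∉ =
  let (wellFormed t l r , z∈) = Transl-wf P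
  in renC-id y x (LabelsIn⇒Avoids {G = G} l x∉) , renG-id y x x∉ (IsLabelTree.arcsNodes t)
   , renC-id y x (LabelsIn⇒Avoids {G = G} r x∉) , ren-miss y x _ (∈⇒≢ x∉ z∈)

reroot : ∀ {Γ Δ x s} y → Transl Γ Δ x s → y ∉ nodes (LSeq.tree s) → Σ LSeq λ s' → Transl Γ Δ y s' × (s' ∼ renS y x s)
reroot {x = x} y empty y∉ = _ , empty , ≡⇒∼ (cong (λ r → [] ⊢[ graph (r ∷ []) [] ] []) (sym (ren-hit y x)))
reroot {x = x} y (consL P (formula {A = A} {Λ = Λ})) y∉ =
  let (s' , P' , (a , b , c)) = reroot y P y∉
  in _ , consL P' formula , (↭-trans (prep _ a) (↭-reflexive (cong (λ r → (r , A) ∷ renC y x Λ) (sym (ren-hit y x)))) , b , c)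
reroot {x = x} y (consR P (formula {A = A} {Π = Π})) y∉ =
  let (s' , P' , (a , b , c)) = reroot y P y∉
  in _ , consR P' formula , (a , b , ↭-trans (prep _ c) (↭-reflexive (cong (λ r → (r , A) ∷ renC y x Π) (sym (ren-hit y x)))))
reroot {x = x} y (consL P (nested {y = z} {Λ = Λ} {G = G} {Π = Π} {Λ₀ = Λ₀} {G₀ = G₀} {Π₀ = Π₀} P₀ d)) y∉
  with reroot y P (λ q → y∉ (∈-⊕ʳ (G₀ ⊕ arc z x) G q))
... | _ , P' , (a , b , c) =
  _ , consL P' (nested P₀ (Disjoint-≅ (≅-sym b) (Disjoint-renG d y∉G₀)))
  , ∼-trans (↭.++⁺ʳ _ a , ⊕-cong ≅-refl b , ↭.++⁺ˡ _ c) renamed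
  where
  y∉G₀ : y ∉ nodes G₀
  y∉G₀ q = y∉ (∈-⊕ˡ (G₀ ⊕ arc z x) G (∈-⊕ˡ G₀ (arc z x) q))
  renamed : (renC y x Λ ++ Λ₀ ⊢[ G₀ ⊕ arc z y ⊕ renG y x G ] Π₀ ++ renC y x Π) ∼ renS y x (Λ ++ Λ₀ ⊢[ G₀ ⊕ arc z x ⊕ G ] Π₀ ++ Π)
  renamed with ren-fresh {y = y} P₀ (Disjoint-∉ˡ d (root∈ P))
  ... | Λ₀-fixed , G₀-fixed , Π₀-fixed , z-fixed =
    ≡⇒∼ (⊢-cong (sym (≡-trans (renC-++ y x Λ Λ₀) (cong (renC y x Λ ++_) Λ₀-fixed)))
                (sym (≡-trans (renG-⊕ y x (G₀ ⊕ arc z x) G)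
                       (cong (_⊕ renG y x G) (≡-trans (renG-⊕ y x G₀ (arc z x)) (cong₂ _⊕_ G₀-fixed (cong₂ arc z-fixed (ren-hit y x)))))))
                (sym (≡-trans (renC-++ y x Π₀ Π) (cong (_++ renC y x Π) Π₀-fixed))))
reroot {x = x} y (consR P (nested {y = z} {Λ = Λ} {G = G} {Π = Π} {Λ₀ = Λ₀} {G₀ = G₀} {Π₀ = Π₀} P₀ d)) y∉
  with reroot y P (λ q → y∉ (∈-⊕ˡ (G ⊕ arc x z) G₀ (∈-⊕ˡ G (arc x z) q)))
... | _ , P' , (a , b , c) =
  _ , consR P' (nested P₀ (Disjoint-≅ (≅-sym b) (Disjoint-renG d y∉G₀)))
  , ∼-trans (↭.++⁺ʳ _ a , ⊕-cong (⊕-cong b ≅-refl) ≅-refl , ↭.++⁺ˡ _ c) renamed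
  where
  y∉G₀ : y ∉ nodes G₀
  y∉G₀ q = y∉ (∈-⊕ʳ (G ⊕ arc x z) G₀ q)
  renamed : (renC y x Λ ++ Λ₀ ⊢[ renG y x G ⊕ arc y z ⊕ G₀ ] Π₀ ++ renC y x Π) ∼ renS y x (Λ ++ Λ₀ ⊢[ G ⊕ arc x z ⊕ G₀ ] Π₀ ++ Π)
  renamed with ren-fresh {y = y} P₀ (Disjoint-∉ˡ d (root∈ P))
  ... | Λ₀-fixed , G₀-fixed , Π₀-fixed , z-fixed =
    ≡⇒∼ (⊢-cong (sym (≡-trans (renC-++ y x Λ Λ₀) (cong (renC y x Λ ++_) Λ₀-fixed)))
                (sym (≡-trans (renG-⊕ y x (G ⊕ arc x z) G₀)
                       (cong₂ _⊕_ (≡-trans (renG-⊕ y x G (arc x z)) (cong (renG y x G ⊕_) (cong₂ arc (ren-hit y x) z-fixed))) G₀-fixed)))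
                (sym (≡-trans (renC-++ y x Π₀ Π) (cong (_++ renC y x Π) Π₀-fixed))))

weakenL : ∀ {Λ G Π x A} → LDeriv (Λ ⊢[ G ] Π) → x ∈ nodes G → LDeriv ((x , A) ∷ Λ ⊢[ G ] Π)
weakenL D x∈ = let wellFormed t l r = LDeriv-wf D in by weakL (WellFormed⇒WF (wellFormed t (x∈ ∷ l) r)) (D ∷ [])

weakenR : ∀ {Λ G Π x A} → LDeriv (Λ ⊢[ G ] Π) → x ∈ nodes G → LDeriv (Λ ⊢[ G ] (x , A) ∷ Π)
weakenR D x∈ = let wellFormed t l r = LDeriv-wf D in by weakR (WellFormed⇒WF (wellFormed t l (x∈ ∷ r))) (D ∷ [])

renG-single : ∀ x y → renG x y (single y) ≡ single x
renG-single x y = cong (λ r → graph (r ∷ []) []) (ren-hit x y)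

-- A new leaf y is an instance of nodesplit with G = {y}.
addPredecessorLeaf : ∀ {Λ K Π x y} → LDeriv (Λ ⊢[ K ] Π) → x ∈ nodes K → y ∉ nodes K
                   → LDeriv (Λ ⊢[ single y ⊕ arc y x ⊕ K ] Π)
addPredecessorLeaf {Λ} {K} {Π} {x} {y} D x∈ y∉ =
  by (nodesplitD {G = single y} {G₀ = K} {x = y} {y = x} (λ z ()) join₁ join₂ join₃)
     (WellFormed⇒WF (wellFormed tree (All.map inK l) (All.map inK r)))
     (LDeriv-∼ D (↭-refl , ≅-sym (subst (λ g → (g ⊕ K) ≅ K) (sym (renG-single x y)) (single-absorbˡ x∈)) , ↭-refl) ∷ [])
  where
  open WellFormed (LDeriv-wf D) renaming (isTree to t ; antLabels to l ; sucLabels to r)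
  inK : ∀ {z} → z ∈ nodes K → z ∈ nodes (single y ⊕ arc y x ⊕ K)
  inK = ∈-⊕ʳ (single y ⊕ arc y x) K
  tree : IsLabelTree (single y ⊕ arc y x ⊕ K)
  tree = bridgeTree (single-tree y) t (Disjoint-single y∉) (here refl) x∈
  join₁ : Join x (renG x y (single y)) K
  join₁ = subst (λ g → Join x g K) (sym (renG-single x y)) (here refl , x∈ , λ { z (here e) _ → e ; z (there ()) _ })
  join₂ : Join y (single y) (arc y x)
  join₂ = here refl , here refl , λ { z (here e) _ → e ; z (there ()) _ }
  join₃ : Join x (single y ⊕ arc y x) K
  join₃ = there (there (here refl)) , x∈ , λ { z (here refl) q → ⊥-elim (y∉ q) ; z (there (here refl)) q → ⊥-elim (y∉ q)
                                             ; z (there (there (here e))) q → e ; z (there (there (there ()))) q }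

addSuccessorLeaf : ∀ {Λ K Π x y} → LDeriv (Λ ⊢[ K ] Π) → x ∈ nodes K → y ∉ nodes K
                 → LDeriv (Λ ⊢[ K ⊕ arc x y ⊕ single y ] Π)
addSuccessorLeaf {Λ} {K} {Π} {x} {y} D x∈ y∉ =
  by (nodesplitU {G = single y} {G₀ = K} {x = y} {y = x} (λ z ()) join₁ join₂ join₃)
     (WellFormed⇒WF (wellFormed tree (All.map inK l) (All.map inK r)))
     (LDeriv-∼ D (↭-refl , ≅-sym (subst (λ g → (K ⊕ g) ≅ K) (sym (renG-single x y)) (single-absorbʳ x∈)) , ↭-refl) ∷ [])
  where
  open WellFormed (LDeriv-wf D) renaming (isTree to t ; antLabels to l ; sucLabels to r)
  inK : ∀ {z} → z ∈ nodes K → z ∈ nodes (K ⊕ arc x y ⊕ single y)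
  inK q = ∈-⊕ˡ (K ⊕ arc x y) (single y) (∈-⊕ˡ K (arc x y) q)
  tree : IsLabelTree (K ⊕ arc x y ⊕ single y)
  tree = bridgeTree t (single-tree y) (Disjoint-sym (Disjoint-single y∉)) x∈ (here refl)
  join₁ : Join x K (renG x y (single y))
  join₁ = subst (λ g → Join x K g) (sym (renG-single x y)) (x∈ , here refl , λ { z _ (here e) → e ; z _ (there ()) })
  join₂ : Join x K (arc x y)
  join₂ = x∈ , here refl , λ { z p (here e) → e ; z p (there (here refl)) → ⊥-elim (y∉ p) ; z p (there (there ())) }
  join₃ : Join y (K ⊕ arc x y) (single y)
  join₃ = ∈-⊕ʳ K (arc x y) (there (here refl)) , here refl , λ { z _ (here e) → e ; z _ (there ()) }

-- The nested parts of t are added one leaf at a time.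
weakenBy : ∀ {Γ Δ x t} → Transl Γ Δ x t → ∀ {s} → LDeriv s → x ∈ nodes (LSeq.tree s) → Meet x (LSeq.tree s) (LSeq.tree t)
         → LDeriv (s ⊞ t)
weakenBy empty {Λ ⊢[ G ] Π} D x∈ m =
  LDeriv-∼ D (↭-sym (↭.++-identityʳ Λ) , ≅-sym (single-absorbʳ x∈) , ↭-sym (↭.++-identityʳ Π))
weakenBy (consL P (formula {A = A} {x = x} {Λ = Λt} {G = Gt})) {Λ ⊢[ G ] Π} D x∈ m =
  LDeriv-∼ (weakenL {A = A} (weakenBy P D x∈ m) (∈-⊕ˡ G Gt x∈)) (↭-sym (↭.shift (x , A) Λ Λt) , ≅-refl , ↭-refl)
weakenBy (consR P (formula {A = A} {x = x} {G = Gt} {Π = Πt})) {Λ ⊢[ G ] Π} D x∈ m =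
  LDeriv-∼ (weakenR {A = A} (weakenBy P D x∈ m) (∈-⊕ˡ G Gt x∈)) (↭-refl , ≅-refl , ↭-sym (↭.shift (x , A) Π Πt))
weakenBy (consL {x = x} P (nested {y = y} {Λ = Λt} {G = Gt} {Π = Πt} {Λ₀ = Λ₀} {G₀ = G₀} {Π₀ = Π₀} P₀ d)) {Λ ⊢[ G ] Π} D x∈ m =
  LDeriv-∼ (weakenBy P₀ withLeaf (here refl) leafMeet)
    ( ↭-reflexive (++-assoc Λ Λt Λ₀)
    , ≅-trans (solve 5 (λ sy a g gt g₀ → ((sy ⊛ a) ⊛ (g ⊛ gt)) ⊛ g₀ ⊜ sy ⊛ (g ⊛ ((g₀ ⊛ a) ⊛ gt)))
                      ≅-refl (single y) (arc y x) G Gt G₀)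
              (single-absorbˡ (∈-⊕ʳ G (G₀ ⊕ arc y x ⊕ Gt) (in₀ (root∈ P₀))))
    , Perm.xy∙z≈x∙zy Π Πt Π₀ )
  where
  in₀ : ∀ {z} → z ∈ nodes G₀ → z ∈ nodes (G₀ ⊕ arc y x ⊕ Gt)
  in₀ q = ∈-⊕ˡ (G₀ ⊕ arc y x) Gt (∈-⊕ˡ G₀ (arc y x) q)
  x∉G₀ : x ∉ nodes G₀
  x∉G₀ = Disjoint-∉ˡ d (root∈ P)
  G₀∉G : ∀ {z} → z ∈ nodes G₀ → z ∉ nodes G
  G₀∉G q p = x∉G₀ (subst (_∈ nodes G₀) (meet m _ p (in₀ q)) q)
  G₀∉ : ∀ {z} → z ∈ nodes G₀ → z ∉ nodes (G ⊕ Gt)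
  G₀∉ q p = [ G₀∉G q , Disjoint-∉ʳ d q ]′ (∈-++⁻ (nodes G) p)
  withLeaf : LDeriv (Λ ++ Λt ⊢[ single y ⊕ arc y x ⊕ (G ⊕ Gt) ] Π ++ Πt)
  withLeaf = addPredecessorLeaf (weakenBy P D x∈ (Meet-sym (Meet-⊆ (∈-⊕ʳ (G₀ ⊕ arc y x) Gt) (Meet-sym m))))
                                (∈-⊕ʳ G Gt (root∈ P)) (G₀∉ (root∈ P₀))
  leafMeet : Meet y (single y ⊕ arc y x ⊕ (G ⊕ Gt)) G₀
  leafMeet = meetAt λ { z (here e) q → e ; z (there (here e)) q → e
                      ; z (there (there (here refl))) q → ⊥-elim (x∉G₀ q) ; z (there (there (there r))) q → ⊥-elim (G₀∉ q r) }
weakenBy (consR {x = x} P (nested {y = y} {Λ = Λt} {G = Gt} {Π = Πt} {Λ₀ = Λ₀} {G₀ = G₀} {Π₀ = Π₀} P₀ d)) {Λ ⊢[ G ] Π} D x∈ m =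
  LDeriv-∼ (weakenBy P₀ withLeaf (∈-⊕ʳ ((G ⊕ Gt) ⊕ arc x y) (single y) (here refl)) leafMeet)
    ( ↭-reflexive (++-assoc Λ Λt Λ₀)
    , ≅-trans (solve 5 (λ sy a g gt g₀ → (((g ⊛ gt) ⊛ a) ⊛ sy) ⊛ g₀ ⊜ sy ⊛ (g ⊛ ((gt ⊛ a) ⊛ g₀)))
                      ≅-refl (single y) (arc x y) G Gt G₀)
              (single-absorbˡ (∈-⊕ʳ G (Gt ⊕ arc x y ⊕ G₀) (in₀ (root∈ P₀))))
    , Perm.xy∙z≈x∙zy Π Πt Π₀ )
  where
  in₀ : ∀ {z} → z ∈ nodes G₀ → z ∈ nodes (Gt ⊕ arc x y ⊕ G₀)
  in₀ = ∈-⊕ʳ (Gt ⊕ arc x y) G₀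
  x∉G₀ : x ∉ nodes G₀
  x∉G₀ = Disjoint-∉ˡ d (root∈ P)
  G₀∉G : ∀ {z} → z ∈ nodes G₀ → z ∉ nodes G
  G₀∉G q p = x∉G₀ (subst (_∈ nodes G₀) (meet m _ p (in₀ q)) q)
  G₀∉ : ∀ {z} → z ∈ nodes G₀ → z ∉ nodes (G ⊕ Gt)
  G₀∉ q p = [ G₀∉G q , Disjoint-∉ʳ d q ]′ (∈-++⁻ (nodes G) p)
  withLeaf : LDeriv (Λ ++ Λt ⊢[ (G ⊕ Gt) ⊕ arc x y ⊕ single y ] Π ++ Πt)
  withLeaf = addSuccessorLeaf (weakenBy P D x∈ (Meet-sym (Meet-⊆ (λ q → ∈-⊕ˡ (Gt ⊕ arc x y) G₀ (∈-⊕ˡ Gt (arc x y) q)) (Meet-sym m))))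
                              (∈-⊕ʳ G Gt (root∈ P)) (G₀∉ (root∈ P₀))
  leafMeet : Meet y ((G ⊕ Gt) ⊕ arc x y ⊕ single y) G₀
  leafMeet = meetAt λ z p q → leaf (∈-++⁻ (nodes ((G ⊕ Gt) ⊕ arc x y)) p) q
    where
    leaf : ∀ {z} → z ∈ nodes ((G ⊕ Gt) ⊕ arc x y) ⊎ z ∈ nodes (single y) → z ∈ nodes G₀ → z ≡ y
    leaf (inj₂ (here e)) q = e
    leaf (inj₁ r) q with ∈-++⁻ (nodes (G ⊕ Gt)) r
    ... | inj₁ r' = ⊥-elim (G₀∉ q r')
    ... | inj₂ (here refl) = ⊥-elim (x∉G₀ q)
    ... | inj₂ (there (here e)) = e

-- renC y x L is L with its formulas at x moved to the successor y.
monotoneL : ∀ {G x y Π} L R → Arc G x y → LDeriv (renC y x L ++ R ⊢[ G ] Π) → LabelsIn L G → LDeriv (L ++ R ⊢[ G ] Π)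
monotoneL [] R a D l = D
monotoneL {G} {x} {y} {Π} ((z , A) ∷ L) R a D (z∈ ∷ l) =
  atRoot (z ≟ x) (LDeriv-∼ moved (↭.shift (ren y x z , A) L R , ≅-refl , ↭-refl))
  where
  moved : LDeriv (L ++ (ren y x z , A) ∷ R ⊢[ G ] Π)
  moved = monotoneL L ((ren y x z , A) ∷ R) a (LDeriv-∼ D (↭-sym (↭.shift (ren y x z , A) (renC y x L) R) , ≅-refl , ↭-refl)) l
  atRoot : Dec (z ≡ x) → LDeriv ((ren y x z , A) ∷ L ++ R ⊢[ G ] Π) → LDeriv ((z , A) ∷ L ++ R ⊢[ G ] Π)
  atRoot (yes refl) D' rewrite ren-hit y z =
    let wellFormed t l' r = LDeriv-wf D'
    in by (monotL a) (WellFormed⇒WF (wellFormed t (z∈ ∷ All.tail l') r)) (weakenL D' z∈ ∷ [])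
  atRoot (no z≢x) D' rewrite ren-miss y x z z≢x = D'

monotoneR : ∀ {G x y Λ} L R → Arc G y x → LDeriv (Λ ⊢[ G ] renC y x L ++ R) → LabelsIn L G → LDeriv (Λ ⊢[ G ] L ++ R)
monotoneR [] R a D l = D
monotoneR {G} {x} {y} {Λ} ((z , A) ∷ L) R a D (z∈ ∷ l) =
  atRoot (z ≟ x) (LDeriv-∼ moved (↭-refl , ≅-refl , ↭.shift (ren y x z , A) L R))
  where
  moved : LDeriv (Λ ⊢[ G ] L ++ (ren y x z , A) ∷ R)
  moved = monotoneR L ((ren y x z , A) ∷ R) a (LDeriv-∼ D (↭-refl , ≅-refl , ↭-sym (↭.shift (ren y x z , A) (renC y x L) R))) l
  atRoot : Dec (z ≡ x) → LDeriv (Λ ⊢[ G ] (ren y x z , A) ∷ L ++ R) → LDeriv (Λ ⊢[ G ] (z , A) ∷ L ++ R)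
  atRoot (yes refl) D' rewrite ren-hit y z =
    let wellFormed t l' r = LDeriv-wf D'
    in by (monotR a) (WellFormed⇒WF (wellFormed t l' (z∈ ∷ All.tail r)))
          (LDeriv-∼ (weakenR D' z∈) (↭-refl , ≅-refl , ↭-swap _ _ ↭-refl) ∷ [])
  atRoot (no z≢x) D' rewrite ren-miss y x z z≢x = D'

fresh : Graph → Label
fresh G = suc (foldr _⊔_ 0 (nodes G))

fresh∉ : ∀ G → fresh G ∉ nodes G
fresh∉ G q = <-irrefl refl (≤max (nodes G) q)
  where
  ≤max : ∀ {z} L → z ∈ L → z ≤ foldr _⊔_ 0 L
  ≤max (w ∷ L) (here refl) = m≤m⊔n w (foldr _⊔_ 0 L)
  ≤max (w ∷ L) (there q) = ≤-trans (≤max L q) (m≤n⊔m w (foldr _⊔_ 0 L))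

root-noSuccessor : ∀ {Γ x s} → Transl Γ [] x s → ∀ z → ¬ Arc (LSeq.tree s) x z
root-noSuccessor empty z ()
root-noSuccessor (consL P formula) z a = root-noSuccessor P z a
root-noSuccessor {x = x} (consL P (nested {y = y} {G = G} {G₀ = G₀} Pn d)) z a with ∈-++⁻ (arcs (G₀ ⊕ arc y x)) a
... | inj₂ a' = root-noSuccessor P z a'
... | inj₁ a' with ∈-++⁻ (arcs G₀) a'
...   | inj₁ a₀ = disjoint-∉ d x (root∈ P) (proj₁ (IsLabelTree.arcsNodes (isTree (proj₁ (Transl-wf Pn))) a₀))
...   | inj₂ (here refl) = disjoint-∉ d x (root∈ P) (root∈ Pn)

root-noPredecessor : ∀ {Δ x s} → Transl [] Δ x s → ∀ z → ¬ Arc (LSeq.tree s) z x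
root-noPredecessor empty z ()
root-noPredecessor (consR P formula) z a = root-noPredecessor P z a
root-noPredecessor {x = x} (consR P (nested {y = y} {G = G} {G₀ = G₀} Pn d)) z a with ∈-++⁻ (arcs (G ⊕ arc x y)) a
... | inj₂ a₀ = disjoint-∉ d x (root∈ P) (proj₂ (IsLabelTree.arcsNodes (isTree (proj₁ (Transl-wf Pn))) a₀))
... | inj₁ a' with ∈-++⁻ (arcs G) a'
...   | inj₁ a₁ = root-noPredecessor P z a₁
...   | inj₂ (here refl) = disjoint-∉ d x (root∈ P) (root∈ Pn)

suc-avoidsRoot : ∀ {Γ x s} → Transl Γ [] x s → Avoids x (LSeq.lsuc s)
suc-avoidsRoot empty = []
suc-avoidsRoot (consL P formula) = suc-avoidsRoot P
suc-avoidsRoot (consL P (nested {G₀ = G₀} Pn d)) =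
  All-++⁺ (LabelsIn⇒Avoids {G = G₀} (sucLabels (proj₁ (Transl-wf Pn))) (Disjoint-∉ˡ d (root∈ P))) (suc-avoidsRoot P)

ant-avoidsRoot : ∀ {Δ x s} → Transl [] Δ x s → Avoids x (LSeq.lant s)
ant-avoidsRoot empty = []
ant-avoidsRoot (consR P formula) = ant-avoidsRoot P
ant-avoidsRoot (consR P (nested {G₀ = G₀} Pn d)) =
  All-++⁺ (ant-avoidsRoot P) (LabelsIn⇒Avoids {G = G₀} (antLabels (proj₁ (Transl-wf Pn))) (Disjoint-∉ˡ d (root∈ P)))

Meet-renG : ∀ {z x G H} → Disjoint G H → Meet z H (renG z x G)
Meet-renG {G = G} d = meetAt λ w p q → [ (λ e → e) , (λ r → ⊥-elim (disjoint-∉ d w (proj₁ r) p)) ]′ (renG-∈⁻ G q)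

graftʳ : ∀ {Γa Δa Γb Δb z x sa sb} → Transl Γa Δa z sa → Transl Γb Δb x sb → Disjoint (LSeq.tree sb) (LSeq.tree sa)
       → Σ LSeq λ s → Transl (Γa ++ Γb) (Δa ++ Δb) z s × (s ∼ sa ⊞ renS z x sb)
graftʳ {z = z} {x} {sb = _ ⊢[ _ ] _} Pa Pb d =
  let (r , R , r∼) = reroot z Pb (Disjoint-∉ʳ d (root∈ Pa))
      (s , P , s∼) = append Pa R (Meet-sym (Meet-⊆ (≅⇒⊆ (proj₁ (proj₂ r∼))) (Meet-sym (Meet-renG {x = x} d))))
  in s , P , ∼-trans s∼ (⊞-cong ∼-refl r∼)

graftˡ : ∀ {Γa Δa Γb Δb z x sa sb} → Transl Γa Δa x sa → Transl Γb Δb z sb → Disjoint (LSeq.tree sa) (LSeq.tree sb)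
       → Σ LSeq λ s → Transl (Γa ++ Γb) (Δa ++ Δb) z s × (s ∼ renS z x sa ⊞ sb)
graftˡ {z = z} {x} {sa = _ ⊢[ _ ] _} Pa Pb d =
  let (r , R , r∼) = reroot z Pa (Disjoint-∉ʳ d (root∈ Pb))
      (s , P , s∼) = append R Pb (Meet-⊆ (≅⇒⊆ (proj₁ (proj₂ r∼))) (Meet-sym (Meet-renG {x = x} d)))
  in s , P , ∼-trans s∼ (⊞-cong r∼ ∼-refl)

-- nodesplit separates the root x of a one-sided translation from the root y
-- of a nested one, identified in the premise; monotonicity then moves the
-- formulas back from y to x.

splitDown : ∀ {Γ x Λ₁ G₁ Π₁ Γ₀ Δ₀ y Λ H Π}
          → Transl Γ [] x (Λ₁ ⊢[ G₁ ] Π₁) → Transl Γ₀ Δ₀ y (Λ ⊢[ H ] Π) → Disjoint G₁ H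
          → LDeriv (renC y x Λ₁ ++ Λ ⊢[ renG y x G₁ ⊕ H ] Π₁ ++ Π)
          → LDeriv (Λ₁ ++ Λ ⊢[ G₁ ⊕ arc x y ⊕ H ] Π₁ ++ Π)
splitDown {x = x} {Λ₁} {G₁} {y = y} {Λ} {H} P₁ Pn d D =
  monotoneL Λ₁ Λ (∈-++⁺ˡ (∈-++⁺ʳ (arcs G₁) (here refl)))
    (by (nodesplitD {G = G₁} {G₀ = H} (root-noSuccessor P₁) join₁ join₂ join₃)
        (WellFormed⇒WF (wellFormed (bridgeTree t₁ tn d x∈ y∈)
                                   (All-++⁺ (All.map inRen (LabelsIn-renC {G = G₁} l₁)) (All.map inH ln))
                                   (All-++⁺ (All.map inG₁ r₁) (All.map inH rn))))
        (D ∷ []))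
    (All.map inG₁ l₁)
  where
  open WellFormed (proj₁ (Transl-wf P₁)) renaming (isTree to t₁ ; antLabels to l₁ ; sucLabels to r₁)
  open WellFormed (proj₁ (Transl-wf Pn)) renaming (isTree to tn ; antLabels to ln ; sucLabels to rn)
  x∈ : x ∈ nodes G₁
  x∈ = root∈ P₁
  y∈ : y ∈ nodes H
  y∈ = root∈ Pn
  inG₁ : ∀ {z} → z ∈ nodes G₁ → z ∈ nodes (G₁ ⊕ arc x y ⊕ H)
  inG₁ q = ∈-⊕ˡ (G₁ ⊕ arc x y) H (∈-⊕ˡ G₁ (arc x y) q)
  inH : ∀ {z} → z ∈ nodes H → z ∈ nodes (G₁ ⊕ arc x y ⊕ H)
  inH = ∈-⊕ʳ (G₁ ⊕ arc x y) H
  inRen : ∀ {z} → z ∈ nodes (renG y x G₁) → z ∈ nodes (G₁ ⊕ arc x y ⊕ H)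
  inRen q = [ (λ { refl → inH y∈ }) , (λ r → inG₁ (proj₁ r)) ]′ (renG-∈⁻ G₁ q)
  join₁ : Join y (renG y x G₁) H
  join₁ = subst (_∈ nodes (renG y x G₁)) (ren-hit y x) (renG-∈ G₁ x∈) , y∈ , λ w p q → meet (Meet-renG d) w q p
  join₂ : Join x G₁ (arc x y)
  join₂ = x∈ , here refl , λ { w p (here e) → e ; w p (there (here refl)) → ⊥-elim (disjoint-∉ d w p y∈) }
  join₃ : Join y (G₁ ⊕ arc x y) H
  join₃ = ∈-⊕ʳ G₁ (arc x y) (there (here refl)) , y∈ , λ w p q → [ (λ r → ⊥-elim (disjoint-∉ d w r q)) , atArc q ]′ (∈-++⁻ (nodes G₁) p)
    where
    atArc : ∀ {w} → w ∈ nodes H → w ∈ nodes (arc x y) → w ≡ y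
    atArc q (here refl) = ⊥-elim (disjoint-∉ d _ x∈ q)
    atArc q (there (here e)) = e

splitUp : ∀ {Δ x Λ₂ G₂ Π₂ Γ₀ Δ₀ y Λ H Π}
        → Transl [] Δ x (Λ₂ ⊢[ G₂ ] Π₂) → Transl Γ₀ Δ₀ y (Λ ⊢[ H ] Π) → Disjoint G₂ H
        → LDeriv (Λ ++ Λ₂ ⊢[ H ⊕ renG y x G₂ ] renC y x Π₂ ++ Π)
        → LDeriv (Λ ++ Λ₂ ⊢[ H ⊕ arc y x ⊕ G₂ ] Π₂ ++ Π)
splitUp {x = x} {Λ₂} {G₂} {Π₂} {y = y} {Λ} {H} {Π} P₂ Pn d D =
  monotoneR Π₂ Π (∈-++⁺ˡ (∈-++⁺ʳ (arcs H) (here refl)))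
    (by (nodesplitU {G = G₂} {G₀ = H} (root-noPredecessor P₂) join₁ join₂ join₃)
        (WellFormed⇒WF (wellFormed (bridgeTree tn t₂ (Disjoint-sym d) y∈ x∈)
                                   (All-++⁺ (All.map inH ln) (All.map inG₂ l₂))
                                   (All-++⁺ (All.map inRen (LabelsIn-renC {G = G₂} r₂)) (All.map inH rn))))
        (D ∷ []))
    (All.map inG₂ r₂)
  where
  open WellFormed (proj₁ (Transl-wf P₂)) renaming (isTree to t₂ ; antLabels to l₂ ; sucLabels to r₂)
  open WellFormed (proj₁ (Transl-wf Pn)) renaming (isTree to tn ; antLabels to ln ; sucLabels to rn)
  x∈ : x ∈ nodes G₂
  x∈ = root∈ P₂
  y∈ : y ∈ nodes H
  y∈ = root∈ Pn
  inG₂ : ∀ {z} → z ∈ nodes G₂ → z ∈ nodes (H ⊕ arc y x ⊕ G₂)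
  inG₂ = ∈-⊕ʳ (H ⊕ arc y x) G₂
  inH : ∀ {z} → z ∈ nodes H → z ∈ nodes (H ⊕ arc y x ⊕ G₂)
  inH q = ∈-⊕ˡ (H ⊕ arc y x) G₂ (∈-⊕ˡ H (arc y x) q)
  inRen : ∀ {z} → z ∈ nodes (renG y x G₂) → z ∈ nodes (H ⊕ arc y x ⊕ G₂)
  inRen q = [ (λ { refl → inH y∈ }) , (λ r → inG₂ (proj₁ r)) ]′ (renG-∈⁻ G₂ q)
  join₁ : Join y H (renG y x G₂)
  join₁ = y∈ , subst (_∈ nodes (renG y x G₂)) (ren-hit y x) (renG-∈ G₂ x∈) , meet (Meet-renG d)
  join₂ : Join y H (arc y x)
  join₂ = y∈ , here refl , λ { w p (here e) → e ; w p (there (here refl)) → ⊥-elim (disjoint-∉ d w x∈ p) }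
  join₃ : Join x (H ⊕ arc y x) G₂
  join₃ = ∈-⊕ʳ H (arc y x) (there (here refl)) , x∈ , λ w p q → [ (λ r → ⊥-elim (disjoint-∉ d w q r)) , atArc q ]′ (∈-++⁻ (nodes H) p)
    where
    atArc : ∀ {w} → w ∈ nodes G₂ → w ∈ nodes (arc y x) → w ≡ x
    atArc q (here refl) = ⊥-elim (disjoint-∉ d _ q y∈)
    atArc q (there (here e)) = e

attachPredecessor : ∀ {Γ₀ Δ₀ Γ Δ x z Λ₁ G₁ Π₁ Λ₂ G₂ Π₂ Λn Gn Πn}
  → (∀ {y t} → Transl Γ₀ (Δ₀ ++ Δ) y t → LDeriv t)
  → Transl Γ [] x (Λ₁ ⊢[ G₁ ] Π₁) → Transl [] Δ x (Λ₂ ⊢[ G₂ ] Π₂) → Meet x G₁ G₂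
  → Transl Γ₀ Δ₀ z (Λn ⊢[ Gn ] Πn) → Disjoint (G₁ ⊕ G₂) Gn
  → LDeriv ((Λ₁ ++ Λ₂) ++ Λn ⊢[ Gn ⊕ arc z x ⊕ (G₁ ⊕ G₂) ] Πn ++ (Π₁ ++ Π₂))
attachPredecessor {Γ₀} {Δ₀} {Δ = Δ} {x} {z} {Λ₁} {G₁} {Π₁} {Λ₂} {G₂} {Π₂} {Λn} {Gn} {Πn} ih P₁ P₂ m Pn d =
  let (s , P , s∼) = graftʳ Pn P₂ (Disjoint-⊕⁻ʳ d)
      premise : LDeriv (Λn ++ Λ₂ ⊢[ Gn ⊕ renG z x G₂ ] renC z x Π₂ ++ Πn)
      premise = LDeriv-∼ (ih (subst (λ Γ' → Transl Γ' (Δ₀ ++ Δ) z s) (++-identityʳ Γ₀) P))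
                         (∼-trans s∼ ( ↭.++⁺ˡ Λn (↭-reflexive (renC-id z x (ant-avoidsRoot P₂)))
                                     , ≅-refl , ↭.++-comm Πn (renC z x Π₂) ))
  in LDeriv-∼ (weakenBy P₁ (splitUp P₂ Pn (Disjoint-⊕⁻ʳ d) premise) (∈-⊕ʳ (Gn ⊕ arc z x) G₂ (root∈ P₂)) meetG₁)
       ( Perm.xy∙z≈zy∙x Λn Λ₂ Λ₁
       , solve 4 (λ gn a g₂ g₁ → ((gn ⊛ a) ⊛ g₂) ⊛ g₁ ⊜ (gn ⊛ a) ⊛ (g₁ ⊛ g₂)) ≅-refl Gn (arc z x) G₂ G₁
       , Perm.xy∙z≈y∙zx Π₂ Πn Π₁ )
  where
  meetG₁ : Meet x (Gn ⊕ arc z x ⊕ G₂) G₁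
  meetG₁ = Meet-⊕ (Meet-⊕ (Meet-disjoint (Disjoint-sym (Disjoint-⊕⁻ˡ d)))
                          (Meet-arcTo (λ q → disjoint-∉ d z (∈-⊕ˡ G₁ G₂ q) (root∈ Pn))))
                  (Meet-sym m)

attachSuccessor : ∀ {Γ₀ Δ₀ Γ Δ x z Λ₁ G₁ Π₁ Λ₂ G₂ Π₂ Λn Gn Πn}
  → (∀ {y t} → Transl (Γ ++ Γ₀) Δ₀ y t → LDeriv t)
  → Transl Γ [] x (Λ₁ ⊢[ G₁ ] Π₁) → Transl [] Δ x (Λ₂ ⊢[ G₂ ] Π₂) → Meet x G₁ G₂
  → Transl Γ₀ Δ₀ z (Λn ⊢[ Gn ] Πn) → Disjoint (G₁ ⊕ G₂) Gn
  → LDeriv ((Λ₁ ++ Λ₂) ++ Λn ⊢[ (G₁ ⊕ G₂) ⊕ arc x z ⊕ Gn ] Πn ++ (Π₁ ++ Π₂))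
attachSuccessor {x = x} {z} {Λ₁} {G₁} {Π₁} {Λ₂} {G₂} {Π₂} {Λn} {Gn} {Πn} ih P₁ P₂ m Pn d =
  let (s , P , s∼) = graftˡ P₁ Pn (Disjoint-⊕⁻ˡ d)
      premise : LDeriv (renC z x Λ₁ ++ Λn ⊢[ renG z x G₁ ⊕ Gn ] Π₁ ++ Πn)
      premise = LDeriv-∼ (ih P) (∼-trans s∼ (↭-refl , ≅-refl , ↭.++⁺ʳ Πn (↭-reflexive (renC-id z x (suc-avoidsRoot P₁)))))
  in LDeriv-∼ (weakenBy P₂ (splitDown P₁ Pn (Disjoint-⊕⁻ˡ d) premise) (∈-⊕ˡ (G₁ ⊕ arc x z) Gn (∈-⊕ˡ G₁ (arc x z) (root∈ P₁))) meetG₂)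
       ( Perm.xy∙z≈xz∙y Λ₁ Λn Λ₂
       , solve 4 (λ g₁ a gn g₂ → ((g₁ ⊛ a) ⊛ gn) ⊛ g₂ ⊜ ((g₁ ⊛ g₂) ⊛ a) ⊛ gn) ≅-refl G₁ (arc x z) Gn G₂
       , Perm.xy∙z≈y∙xz Π₁ Πn Π₂ )
  where
  meetG₂ : Meet x (G₁ ⊕ arc x z ⊕ Gn) G₂
  meetG₂ = Meet-⊕ (Meet-⊕ m (Meet-arcFrom (λ q → disjoint-∉ d z (∈-⊕ʳ G₁ G₂ q) (root∈ Pn))))
                  (Meet-disjoint (Disjoint-sym (Disjoint-⊕⁻ʳ d)))

translate-nestL : ∀ {Γ₀ Δ₀ Γ Δ x s} → (∀ {y t} → Transl Γ₀ (Δ₀ ++ Δ) y t → LDeriv t) → Transl (nest Γ₀ Δ₀ ∷ Γ) Δ x s → LDeriv s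
translate-nestL ih P with invL P
... | _ , _ , P₀ , nested Pn d , s∼ =
  let ((_ ⊢[ _ ] _) , (_ ⊢[ _ ] _) , P₁ , P₂ , m , (a , b , c)) = splitSides P₀
  in LDeriv-∼ (attachPredecessor ih P₁ P₂ m Pn (Disjoint-≅ (≅-sym b) d))
              (∼-trans (↭.++⁺ʳ _ a , ⊕-cong ≅-refl b , ↭.++⁺ˡ _ c) s∼)

translate-nestR : ∀ {Γ₀ Δ₀ Γ Δ x s} → (∀ {y t} → Transl (Γ ++ Γ₀) Δ₀ y t → LDeriv t) → Transl Γ (nest Γ₀ Δ₀ ∷ Δ) x s → LDeriv s
translate-nestR ih P with invR P
... | _ , _ , P₀ , nested Pn d , s∼ =
  let ((_ ⊢[ _ ] _) , (_ ⊢[ _ ] _) , P₁ , P₂ , m , (a , b , c)) = splitSides P₀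
  in LDeriv-∼ (attachSuccessor ih P₁ P₂ m Pn (Disjoint-≅ (≅-sym b) d))
              (∼-trans (↭.++⁺ʳ _ a , ⊕-cong (⊕-cong b ≅-refl) ≅-refl , ↭.++⁺ˡ _ c) s∼)

leaf : ∀ {A B z} → Transl (fml A ∷ []) (fml B ∷ []) z ((z , A) ∷ [] ⊢[ single z ] (z , B) ∷ [])
leaf = consR (consL empty formula) formula

translate-⊃R : ∀ {A B Γ Δ x s} → (∀ {y t} → Transl (fml A ∷ Γ) (fml B ∷ []) y t → LDeriv t) → Transl Γ (fml (A ⊃ B) ∷ Δ) x s → LDeriv s
translate-⊃R {A} {B} {Γ} {x = x} ih P with invR P
... | _ , _ , P₀ , formula , s∼ =
  let ((Λ₁ ⊢[ G₁ ] Π₁) , (Λ₂ ⊢[ G₂ ] Π₂) , P₁ , P₂ , m , (a , b , c)) = splitSides P₀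
      y = fresh (G₁ ⊕ G₂)
      y∉ = fresh∉ (G₁ ⊕ G₂)
      conclusion∼ : (Λ₁ ++ Λ₂ ⊢[ G₁ ⊕ G₂ ] (x , A ⊃ B) ∷ (Π₁ ++ Π₂)) ∼ _
      conclusion∼ = ∼-trans (a , b , prep _ c) s∼
      premise = attachSuccessor ih′ P₁ P₂ m (leaf {A} {B} {y}) (Disjoint-sym (Disjoint-single y∉))
  in LDeriv-∼ (by (⊃R y∉ (∈-⊕ˡ G₁ G₂ (root∈ P₁) , here refl , λ { w p (here e) → e ; w p (there (here refl)) → ⊥-elim (y∉ p) }))
                  (WellFormed⇒WF (WellFormed-∼ (∼-sym conclusion∼) (proj₁ (Transl-wf P))))
                  (LDeriv-∼ premise (↭.++-comm (Λ₁ ++ Λ₂) _ , single-absorbʳ (∈-⊕ʳ (G₁ ⊕ G₂) (arc x y) (there (here refl))) , ↭-refl) ∷ []))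
              conclusion∼
  where
  ih′ : ∀ {y t} → Transl (Γ ++ fml A ∷ []) (fml B ∷ []) y t → LDeriv t
  ih′ P′ = let (_ , P″ , t∼) = Transl-≈Cˡ (∷≈C∷ʳ (fml A) Γ) P′ in LDeriv-∼ (ih P″) t∼

translate-−<L : ∀ {A B Γ Δ x s} → (∀ {y t} → Transl (fml A ∷ []) (fml B ∷ Δ) y t → LDeriv t) → Transl (fml (A −< B) ∷ Γ) Δ x s → LDeriv s
translate-−<L {A} {B} {x = x} ih P with invL P
... | _ , _ , P₀ , formula , s∼ =
  let ((Λ₁ ⊢[ G₁ ] Π₁) , (Λ₂ ⊢[ G₂ ] Π₂) , P₁ , P₂ , m , (a , b , c)) = splitSides P₀
      y = fresh (G₁ ⊕ G₂)
      y∉ = fresh∉ (G₁ ⊕ G₂)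
      conclusion∼ : ((x , A −< B) ∷ (Λ₁ ++ Λ₂) ⊢[ G₁ ⊕ G₂ ] Π₁ ++ Π₂) ∼ _
      conclusion∼ = ∼-trans (prep _ a , b , c) s∼
      premise = attachPredecessor ih P₁ P₂ m (leaf {A} {B} {y}) (Disjoint-sym (Disjoint-single y∉))
  in LDeriv-∼ (by (−<L y∉ (there (here refl) , ∈-⊕ˡ G₁ G₂ (root∈ P₁) , λ { w (here refl) q → ⊥-elim (y∉ q) ; w (there (here e)) q → e }))
                  (WellFormed⇒WF (WellFormed-∼ (∼-sym conclusion∼) (proj₁ (Transl-wf P))))
                  (LDeriv-∼ premise ( ↭.++-comm (Λ₁ ++ Λ₂) _
                                    , ≅-trans (CommutativeMonoid.assoc ⊕-commutativeMonoid (single y) (arc y x) (G₁ ⊕ G₂))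
                                              (single-absorbˡ (here refl))
                                    , ↭-refl ) ∷ []))
              conclusion∼

module Unnest {Γ Δ Γ₀ Δ₀ x Λg Gg Πg Λc Gc Πc}
  (Pg : Transl Γ Δ x (Λg ⊢[ Gg ] Πg)) (Pc : Transl Γ₀ Δ₀ x (Λc ⊢[ Gc ] Πc)) (mg : Meet x Gg Gc) where

  y : Label
  y = fresh (Gg ⊕ Gc)

  y∉Gg : y ∉ nodes Gg
  y∉Gg q = fresh∉ (Gg ⊕ Gc) (∈-⊕ˡ Gg Gc q)

  y∉Gc : y ∉ nodes Gc
  y∉Gc q = fresh∉ (Gg ⊕ Gc) (∈-⊕ʳ Gg Gc q)

  rerooted : Σ LSeq λ r → Transl Γ₀ Δ₀ y r × (r ∼ renS y x (Λc ⊢[ Gc ] Πc))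
  rerooted = reroot y Pc y∉Gc

  Pr : Transl Γ₀ Δ₀ y (proj₁ rerooted)
  Pr = proj₁ (proj₂ rerooted)

  r∼ : proj₁ rerooted ∼ renS y x (Λc ⊢[ Gc ] Πc)
  r∼ = proj₂ (proj₂ rerooted)

  disjointRenamed : Disjoint Gg (renG y x Gc)
  disjointRenamed = disjoint λ w p q → [ (λ { refl → y∉Gg p }) , (λ { (q' , w≢x) → w≢x (meet mg w p q') }) ]′ (renG-∈⁻ Gc q)

  disjointRoot : Disjoint Gg (LSeq.tree (proj₁ rerooted))
  disjointRoot = Disjoint-sym (Disjoint-≅ (≅-sym (proj₁ (proj₂ r∼))) (Disjoint-sym disjointRenamed))

  y∈renamed : y ∈ nodes (renG y x Gc)
  y∈renamed = subst (_∈ nodes (renG y x Gc)) (ren-hit y x) (renG-∈ Gc (root∈ Pc))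

  x∉renamed : x ∉ nodes (renG y x Gc)
  x∉renamed q = [ (λ e → y∉Gg (subst (_∈ nodes Gg) e (root∈ Pg))) , (λ r → proj₂ r refl) ]′ (renG-∈⁻ Gc q)

  renamedBack : renS x y (Λg ++ renC y x Λc ⊢[ renG y x Gc ] renC y x Πc ++ Πg) ≡ (Λg ++ Λc ⊢[ Gc ] Πc ++ Πg)
  renamedBack =
    let (wellFormed tg lg rg , _) = Transl-wf Pg
        (wellFormed tc lc rc , _) = Transl-wf Pc
    in ⊢-cong (≡-trans (renC-++ x y Λg (renC y x Λc))
                       (cong₂ _++_ (renC-id x y (LabelsIn⇒Avoids {G = Gg} lg y∉Gg)) (renC-inv x y Λc (LabelsIn⇒Avoids {G = Gc} lc y∉Gc))))
              (renG-inv x y y∉Gc (IsLabelTree.arcsNodes tc))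
              (≡-trans (renC-++ x y (renC y x Πc) Πg)
                       (cong₂ _++_ (renC-inv x y Πc (LabelsIn⇒Avoids {G = Gc} rc y∉Gc)) (renC-id x y (LabelsIn⇒Avoids {G = Gg} rg y∉Gg))))

untranslate-nestL : ∀ {Γ₀ Δ₀ Γ Δ x s} → (∀ {y t} → Transl (nest Γ₀ Δ₀ ∷ Γ) Δ y t → LDeriv t) → Transl (Γ ++ Γ₀) (Δ₀ ++ Δ) x s → LDeriv s
untranslate-nestL {Γ₀} {Δ₀} {Γ} {Δ} {x} {s} ih P with splitNested Γ Γ₀ Δ₀ Δ P
... | (Λg ⊢[ Gg ] Πg) , (Λc ⊢[ Gc ] Πc) , Pg , Pc , mg , s∼ =
  LDeriv-∼ (subst LDeriv merged (by (nodemergeD {G = Gg} {G₀ = renG y x Gc} join₁ join₂ join₃)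
                                    (WellFormed⇒WF (subst WellFormed (sym merged) (WellFormed-∼ (∼-sym conclusion∼) (proj₁ (Transl-wf P)))))
                                    (premise ∷ [])))
           conclusion∼
  where
  open Unnest Pg Pc mg
  conclusion∼ : (Λg ++ Λc ⊢[ Gc ⊕ Gg ] Πc ++ Πg) ∼ s
  conclusion∼ = ∼-trans (↭-refl , ⊕-comm Gc Gg , ↭.++-comm Πc Πg) s∼
  premise : LDeriv (Λg ++ renC y x Λc ⊢[ renG y x Gc ⊕ arc y x ⊕ Gg ] renC y x Πc ++ Πg)
  premise = LDeriv-∼ (ih (consL Pg (nested Pr disjointRoot)))
                     (↭.++⁺ˡ Λg (proj₁ r∼) , ⊕-cong (⊕-cong (proj₁ (proj₂ r∼)) ≅-refl) ≅-refl , ↭.++⁺ʳ Πg (proj₂ (proj₂ r∼)))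
  merged : _ ≡ (Λg ++ Λc ⊢[ Gc ⊕ Gg ] Πc ++ Πg)
  merged = cong (λ { (Λ ⊢[ G ] Π) → Λ ⊢[ G ⊕ Gg ] Π }) renamedBack
  join₁ : Join y (renG y x Gc) (arc y x)
  join₁ = y∈renamed , here refl , λ { w p (here e) → e ; w p (there (here refl)) → ⊥-elim (x∉renamed p) }
  join₂ : Join x (renG y x Gc ⊕ arc y x) Gg
  join₂ = ∈-⊕ʳ (renG y x Gc) (arc y x) (there (here refl)) , root∈ Pg
        , meet (Meet-⊕ (Meet-disjoint (Disjoint-sym disjointRenamed)) (Meet-arcTo y∉Gg))
  join₃ : Join x (renG x y (renG y x Gc)) Gg
  join₃ = subst (λ G → Join x G Gg) (sym (cong LSeq.tree renamedBack)) (root∈ Pc , root∈ Pg , λ w p q → meet mg w q p)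

untranslate-nestR : ∀ {Γ₀ Δ₀ Γ Δ x s} → (∀ {y t} → Transl Γ (nest Γ₀ Δ₀ ∷ Δ) y t → LDeriv t) → Transl (Γ ++ Γ₀) (Δ₀ ++ Δ) x s → LDeriv s
untranslate-nestR {Γ₀} {Δ₀} {Γ} {Δ} {x} {s} ih P with splitNested Γ Γ₀ Δ₀ Δ P
... | (Λg ⊢[ Gg ] Πg) , (Λc ⊢[ Gc ] Πc) , Pg , Pc , mg , s∼ =
  LDeriv-∼ (subst LDeriv merged (by (nodemergeU {G = Gg} {G₀ = renG y x Gc} join₁ join₂ join₃)
                                    (WellFormed⇒WF (subst WellFormed (sym merged) (WellFormed-∼ (∼-sym conclusion∼) (proj₁ (Transl-wf P)))))
                                    (premise ∷ [])))
           conclusion∼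
  where
  open Unnest Pg Pc mg
  conclusion∼ : (Λg ++ Λc ⊢[ Gg ⊕ Gc ] Πc ++ Πg) ∼ s
  conclusion∼ = ∼-trans (↭-refl , ≅-refl , ↭.++-comm Πc Πg) s∼
  premise : LDeriv (Λg ++ renC y x Λc ⊢[ Gg ⊕ arc x y ⊕ renG y x Gc ] renC y x Πc ++ Πg)
  premise = LDeriv-∼ (ih (consR Pg (nested Pr disjointRoot)))
                     (↭.++⁺ˡ Λg (proj₁ r∼) , ⊕-cong ≅-refl (proj₁ (proj₂ r∼)) , ↭.++⁺ʳ Πg (proj₂ (proj₂ r∼)))
  merged : _ ≡ (Λg ++ Λc ⊢[ Gg ⊕ Gc ] Πc ++ Πg)
  merged = cong (λ { (Λ ⊢[ G ] Π) → Λ ⊢[ Gg ⊕ G ] Π }) renamedBack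
  join₁ : Join x Gg (arc x y)
  join₁ = root∈ Pg , here refl , λ { w p (here e) → e ; w p (there (here refl)) → ⊥-elim (y∉Gg p) }
  join₂ : Join y (Gg ⊕ arc x y) (renG y x Gc)
  join₂ = ∈-⊕ʳ Gg (arc x y) (there (here refl)) , y∈renamed
        , meet (Meet-⊕ (Meet-disjoint disjointRenamed) (Meet-arcTo x∉renamed))
  join₃ : Join x Gg (renG x y (renG y x Gc))
  join₃ = subst (Join x Gg) (sym (cong LSeq.tree renamedBack)) (root∈ Pg , root∈ Pc , meet mg)

viewL : ∀ {A Γ Δ x s} → Transl (fml A ∷ Γ) Δ x s
      → Σ LSeq λ s₀ → Transl Γ Δ x s₀ × (((x , A) ∷ LSeq.lant s₀ ⊢[ LSeq.tree s₀ ] LSeq.lsuc s₀) ∼ s)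
viewL P with invL P
... | s₀ , _ , P₀ , formula , s∼ = s₀ , P₀ , s∼

viewR : ∀ {A Γ Δ x s} → Transl Γ (fml A ∷ Δ) x s
      → Σ LSeq λ s₀ → Transl Γ Δ x s₀ × ((LSeq.lant s₀ ⊢[ LSeq.tree s₀ ] (x , A) ∷ LSeq.lsuc s₀) ∼ s)
viewR P with invR P
... | s₀ , _ , P₀ , formula , s∼ = s₀ , P₀ , s∼

byRule : ∀ {ps Γ Δ x s₁ s} → LRule ps s₁ → Transl Γ Δ x s₁ → All LDeriv ps → s₁ ∼ s → LDeriv s
byRule r P ds s∼ = LDeriv-∼ (by r (WellFormed⇒WF (proj₁ (Transl-wf P))) ds) s∼

translate : ∀ {Γ Δ} → NDeriv Γ Δ → ∀ {x s} → Transl Γ Δ x s → LDeriv s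
translate (exch p q D) P = let (_ , P′ , s∼) = Transl-≈C p q P in LDeriv-∼ (translate D P′) s∼
translate hyp P =
  let (_ , P₀ , s∼) = viewL P
      (_ , P₁ , (a , b , c)) = viewR P₀
  in byRule hyp (consL (consR P₁ formula) formula) [] (∼-trans (prep _ a , b , c) s∼)
translate (cut D₁ D₂) P = by cut (WellFormed⇒WF (proj₁ (Transl-wf P))) (translate D₁ (consR P formula) ∷ translate D₂ (consL P formula) ∷ [])
translate (weakL D) P = let (_ , P₀ , s∼) = viewL P in byRule weakL (consL P₀ formula) (translate D P₀ ∷ []) s∼
translate (weakR D) P = let (_ , P₀ , s∼) = viewR P in byRule weakR (consR P₀ formula) (translate D P₀ ∷ []) s∼
translate (contrL D) P = let (_ , P₀ , s∼) = viewL P in byRule contrL (consL P₀ formula) (translate D (consL (consL P₀ formula) formula) ∷ []) s∼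
translate (contrR D) P = let (_ , P₀ , s∼) = viewR P in byRule contrR (consR P₀ formula) (translate D (consR (consR P₀ formula) formula) ∷ []) s∼
translate (⊤L D) P = let (_ , P₀ , s∼) = viewL P in byRule ⊤L (consL P₀ formula) (translate D P₀ ∷ []) s∼
translate ⊤R P = let (_ , P₀ , s∼) = viewR P in byRule ⊤R (consR P₀ formula) [] s∼
translate ⊥L P = let (_ , P₀ , s∼) = viewL P in byRule ⊥L (consL P₀ formula) [] s∼
translate (⊥R D) P = let (_ , P₀ , s∼) = viewR P in byRule ⊥R (consR P₀ formula) (translate D P₀ ∷ []) s∼
translate (∧L D) P = let (_ , P₀ , s∼) = viewL P in byRule ∧L (consL P₀ formula) (translate D (consL (consL P₀ formula) formula) ∷ []) s∼
translate (∧R D₁ D₂) P = let (_ , P₀ , s∼) = viewR P in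
  byRule ∧R (consR P₀ formula) (translate D₁ (consR P₀ formula) ∷ translate D₂ (consR P₀ formula) ∷ []) s∼
translate (∨L D₁ D₂) P = let (_ , P₀ , s∼) = viewL P in
  byRule ∨L (consL P₀ formula) (translate D₁ (consL P₀ formula) ∷ translate D₂ (consL P₀ formula) ∷ []) s∼
translate (∨R D) P = let (_ , P₀ , s∼) = viewR P in byRule ∨R (consR P₀ formula) (translate D (consR (consR P₀ formula) formula) ∷ []) s∼
translate (⊃L D₁ D₂) P = let (_ , P₀ , s∼) = viewL P in
  byRule ⊃L (consL P₀ formula) (translate D₁ (consR (consL P₀ formula) formula) ∷ translate D₂ (consL P₀ formula) ∷ []) s∼
translate (−<R D₁ D₂) P = let (_ , P₀ , s∼) = viewR P in
  byRule −<R (consR P₀ formula) (translate D₁ (consR P₀ formula) ∷ translate D₂ (consL (consR P₀ formula) formula) ∷ []) s∼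
translate (⊃R D) P = translate-⊃R (translate D) P
translate (−<L D) P = translate-−<L (translate D) P
translate (nestL D) P = translate-nestL (translate D) P
translate (nestR D) P = translate-nestR (translate D) P
translate (unnestL D) P = untranslate-nestL (translate D) P
translate (unnestR D) P = untranslate-nestR (translate D) P

-- The labels of trL Γ Δ x n and trR Δ x n are x and the fresh labels drawn from [n, next).
LabelsBetween : Label → ℕ → ℕ → Graph → Set
LabelsBetween x n m G = ∀ z → z ∈ nodes G → z ≡ x ⊎ (n ≤ z × z < m)

seqOf : TR → LSeq
seqOf r = TR.Λ r ⊢[ TR.Gr r ] TR.Π r

Invariant : Ctx → Ctx → Label → ℕ → TR → Set
Invariant Γ Δ x n r = Transl Γ Δ x (seqOf r) × n ≤ TR.next r × LabelsBetween x n (TR.next r) (TR.Gr r)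

LabelsBetween-disjoint : ∀ {x n y m G G₀} → x < n → n ≤ y → LabelsBetween x n y G → LabelsBetween y (suc y) m G₀ → Disjoint G G₀
LabelsBetween-disjoint {x} {n} {y} x<n n≤y b b₀ = disjoint λ z p q → separate (b z p) (b₀ z q)
  where
  separate : ∀ {z} → z ≡ x ⊎ (n ≤ z × z < y) → z ≡ y ⊎ (suc y ≤ z × z < _) → ⊥
  separate (inj₁ refl) (inj₁ refl) = <-irrefl refl (<-≤-trans x<n n≤y)
  separate (inj₁ refl) (inj₂ (h , _)) = <-irrefl refl (<-trans (<-≤-trans x<n n≤y) h)
  separate (inj₂ (_ , l)) (inj₁ refl) = <-irrefl refl l
  separate (inj₂ (_ , l)) (inj₂ (h , _)) = <-irrefl refl (<-trans l h)

LabelsBetween-nested : ∀ {x n y m G₀} → LabelsBetween y (suc y) m G₀ → n ≤ y → y < m → ∀ z → z ∈ nodes G₀ → z ≡ x ⊎ (n ≤ z × z < m)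
LabelsBetween-nested {y = y} b₀ n≤y y<m z q = [ (λ { refl → inj₂ (n≤y , y<m) }) , (λ { (h , l) → inj₂ (≤-trans n≤y (≤-trans (n≤1+n y) h) , l) }) ]′ (b₀ z q)

LabelsBetween-outer : ∀ {x n y m G} → LabelsBetween x n y G → y < m → ∀ z → z ∈ nodes G → z ≡ x ⊎ (n ≤ z × z < m)
LabelsBetween-outer b y<m z q = [ inj₁ , (λ { (h , l) → inj₂ (h , <-trans l y<m) }) ]′ (b z q)

LabelsBetween-arc : ∀ {x n y m} → n ≤ y → y < m → ∀ z → z ∈ nodes (arc x y) → z ≡ x ⊎ (n ≤ z × z < m)
LabelsBetween-arc n≤y y<m z (here e) = inj₁ e
LabelsBetween-arc n≤y y<m z (there (here refl)) = inj₂ (n≤y , y<m)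

LabelsBetween-⊕ : ∀ {x n m G H} → LabelsBetween x n m G → LabelsBetween x n m H → LabelsBetween x n m (G ⊕ H)
LabelsBetween-⊕ {G = G} b b' z p = [ b z , b' z ]′ (∈-++⁻ (nodes G) p)

LabelsBetween-arcTo : ∀ {x n y m} → n ≤ y → y < m → ∀ z → z ∈ nodes (arc y x) → z ≡ x ⊎ (n ≤ z × z < m)
LabelsBetween-arcTo n≤y y<m z (here refl) = inj₂ (n≤y , y<m)
LabelsBetween-arcTo n≤y y<m z (there (here e)) = inj₁ e

LabelsBetween-nestR : ∀ {x n y m} G G₀ → LabelsBetween x n y G → LabelsBetween y (suc y) m G₀ → n ≤ y → y < m
                    → LabelsBetween x n m (G ⊕ arc x y ⊕ G₀)
LabelsBetween-nestR {x} {y = y} G G₀ b b₀ n≤y y<m =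
  LabelsBetween-⊕ {G = G ⊕ arc x y} {H = G₀} (LabelsBetween-⊕ {G = G} {H = arc x y} (LabelsBetween-outer {G = G} b y<m) (LabelsBetween-arc n≤y y<m))
                  (LabelsBetween-nested {G₀ = G₀} b₀ n≤y y<m)

LabelsBetween-nestL : ∀ {x n y m} G G₀ → LabelsBetween x n y G → LabelsBetween y (suc y) m G₀ → n ≤ y → y < m
                    → LabelsBetween x n m (G₀ ⊕ arc y x ⊕ G)
LabelsBetween-nestL {x} {y = y} G G₀ b b₀ n≤y y<m =
  LabelsBetween-⊕ {G = G₀ ⊕ arc y x} {H = G} (LabelsBetween-⊕ {G = G₀} {H = arc y x} (LabelsBetween-nested {G₀ = G₀} b₀ n≤y y<m) (LabelsBetween-arcTo n≤y y<m))
                  (LabelsBetween-outer {G = G} b y<m)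

mutual
  trR-invariant : ∀ Δ x n → x < n → Invariant [] Δ x n (trR Δ x n)
  trR-invariant [] x n x<n = empty , ≤-refl , λ { z (here e) → inj₁ e }
  trR-invariant (fml A ∷ Δ) x n x<n = let (P , n≤ , b) = trR-invariant Δ x n x<n in consR P formula , n≤ , b
  trR-invariant (nest Γ₀ Δ₀ ∷ Δ) x n x<n =
    let (P , n≤y , b) = trR-invariant Δ x n x<n
        y = TR.next (trR Δ x n)
        (P₀ , y<m , b₀) = trL-invariant Γ₀ Δ₀ y (suc y) (n<1+n y)
    in consR P (nested P₀ (LabelsBetween-disjoint x<n n≤y b b₀)) , ≤-trans n≤y (≤-trans (n≤1+n y) y<m)
     , LabelsBetween-nestR (TR.Gr (trR Δ x n)) (TR.Gr (trL Γ₀ Δ₀ y (suc y))) b b₀ n≤y y<m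

  trL-invariant : ∀ Γ Δ x n → x < n → Invariant Γ Δ x n (trL Γ Δ x n)
  trL-invariant [] Δ x n x<n = trR-invariant Δ x n x<n
  trL-invariant (fml A ∷ Γ) Δ x n x<n = let (P , n≤ , b) = trL-invariant Γ Δ x n x<n in consL P formula , n≤ , b
  trL-invariant (nest Γ₀ Δ₀ ∷ Γ) Δ x n x<n =
    let (P , n≤y , b) = trL-invariant Γ Δ x n x<n
        y = TR.next (trL Γ Δ x n)
        (P₀ , y<m , b₀) = trL-invariant Γ₀ Δ₀ y (suc y) (n<1+n y)
    in consL P (nested P₀ (LabelsBetween-disjoint x<n n≤y b b₀)) , ≤-trans n≤y (≤-trans (n≤1+n y) y<m)
     , LabelsBetween-nestL (TR.Gr (trL Γ Δ x n)) (TR.Gr (trL Γ₀ Δ₀ y (suc y))) b b₀ n≤y y<m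

mainTheorem4 : (Γ Δ : Ctx) → NDeriv Γ Δ → (x : Label) → LDeriv (⟦ Γ ⊢ Δ ⟧ x)
mainTheorem4 Γ Δ D x = translate D (proj₁ (trL-invariant Γ Δ x (suc x) (n<1+n x)))
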